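{- Suppose that for every natural number $m$ there exists a natural number $n$ such that the cyclotomic polynomial $\Phi_n$ has height $m$. Then for every natural number $m$ there exists a natural number $n$ such that the unitary cyclotomic polynomial $\Phi^*_n$ has height $m$.
   Context: $\Phi_n$ is the $n$-th cyclotomic polynomial. $d\mid\mid n$ means $d\mid n,\ \gcd(d,n/d)=1$; $(j,n)_*=\max\{d: d\mid j,\ d\mid\mid n\}$; $\Phi^*_n(x)=\prod_{1\le j\le n,\ (j,n)_*=1}(x-e^{2\pi i j/n})$ is the unitary cyclotomic polynomial (it has integer coefficients). The height of a polynomial is the maximum absolute value of its coefficients. -}

module Defs where

open import Data.Bool using (Bool; true; false; _∧_)
open import Data.Nat as ℕ using (ℕ; zero; suc; _⊔_; _∸_; _≡ᵇ_)
open import Data.Nat.Divisibility using (_∣?_)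
open import Data.Nat.GCD using (gcd)
open import Data.Nat.DivMod using (_/_)
open import Data.Integer as ℤ using (ℤ; +_; -_; ∣_∣)
open import Data.List using (List; []; _∷_; _++_; map; foldr; replicate; reverse; zipWith; drop; length; filterᵇ; upTo; sum)
open import Relation.Nullary.Decidable using (⌊_⌋)

-- Polynomials with integer coefficients, as coefficient lists,
-- lowest degree first (trailing zeros allowed; they do not affect height).
Poly : Set
Poly = List ℤ

coeff : Poly → ℕ → ℤ
coeff []       _       = + 0
coeff (c ∷ _)  zero    = c
coeff (_ ∷ cs) (suc k) = coeff cs k

_⊕_ : Poly → Poly → Poly
[]       ⊕ q        = q
p        ⊕ []       = p
(a ∷ p)  ⊕ (b ∷ q)  = (a ℤ.+ b) ∷ (p ⊕ q)

scale : ℤ → Poly → Poly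
scale c = map (c ℤ.*_)

_⊗_ : Poly → Poly → Poly
[]      ⊗ q = []
(a ∷ p) ⊗ q = scale a q ⊕ (+ 0 ∷ (p ⊗ q))

one : Poly
one = + 1 ∷ []

prodP : List Poly → Poly
prodP = foldr _⊗_ one

xn-1 : ℕ → Poly
xn-1 zero    = []
xn-1 (suc k) = (- + 1) ∷ (replicate k (+ 0) ++ (+ 1 ∷ []))

-- Exact division a / b for b with constant term ±1, computed as a power
-- series quotient up to degree N (the q_k with
-- q_k = b_0 (a_k - Σ_{i≥1} b_i q_{k-i}); b_0 = ±1 is its own inverse).
divStep : Poly → Poly → ℕ → List ℤ → List ℤ
divStep a b zero    rev = rev
divStep a b (suc r) rev =
  divStep a b r
    ((coeff b 0 ℤ.* (coeff a (length rev) ℤ.- foldr ℤ._+_ (+ 0) (zipWith ℤ._*_ (drop 1 b) rev))) ∷ rev)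

divP : Poly → Poly → ℕ → Poly
divP a b N = reverse (divStep a b (suc N) [])

divisors : ℕ → List ℕ
divisors n = filterᵇ (λ d → ⌊ d ∣? n ⌋) (map suc (upTo n))

properDivisors : ℕ → List ℕ
properDivisors n = filterᵇ (λ d → ⌊ d ∣? n ⌋) (map suc (upTo (n ∸ 1)))

-- Cyclotomic polynomials via  x^n - 1 = ∏_{d ∣ n} Φ_d,
-- i.e. Φ_n = (x^n - 1) / ∏_{d ∣ n, d < n} Φ_d  (fuel-based recursion).
cycF : ℕ → ℕ → Poly
cycF zero    n = []
cycF (suc f) n = divP (xn-1 n) (prodP (map (cycF f) (properDivisors n))) n

-- Φ n is the n-th cyclotomic polynomial (meaningful for n ≥ 1)
Φ : ℕ → Poly
Φ n = cycF n n

-- d ∥ n : d ∣ n and gcd(d, n/d) = 1   (unitary divisor; d ≥ 1)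
unitaryᵇ : ℕ → ℕ → Bool
unitaryᵇ zero    n = false
unitaryᵇ (suc k) n = ⌊ suc k ∣? n ⌋ ∧ (gcd (suc k) (n / suc k) ≡ᵇ 1)

-- (j, n)_* = max { d : d ∣ j, d ∥ n }
ustar : ℕ → ℕ → ℕ
ustar j n = foldr _⊔_ 0 (filterᵇ (λ d → ⌊ d ∣? j ⌋ ∧ unitaryᵇ d n) (map suc (upTo n)))

-- Unitary cyclotomic polynomial
--   Φ*_n = ∏_{1≤j≤n, (j,n)_*=1} (x - ζ_n^j).
-- Grouping the roots ζ_n^j according to their order d = n / gcd(j,n)
-- (and using (j,n)_* = (gcd(j,n),n)_*), this is
--   Φ*_n = ∏_{d ∣ n, (n/d, n)_* = 1} Φ_d.
Φ* : ℕ → Poly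
Φ* n = prodP (map Φ (filterᵇ (λ d → ustar (n / suc (d ∸ 1)) n ≡ᵇ 1) (divisors n)))

height : Poly → ℕ
height = foldr (λ c m → ∣ c ∣ ⊔ m) 0

{-# OPTIONS --safe #-}
-- If n is squarefree, every divisor of n is unitary, so (j, n)_* = gcd(j, n) and the only
-- divisor d of n with (n/d, n)_* = 1 is d = n; hence Φ*_n = Φ_n. If p² ∣ n for a prime p, then
-- Φ_n(x) = Φ_{n/p}(xᵖ), which has the same coefficients as Φ_{n/p}. So every height of a
-- cyclotomic polynomial is already the height of some Φ_n with n squarefree, and then of Φ*_n.
--
-- Φ_n is defined as the power-series quotient of xⁿ − 1 by ∏_{d ∣ n, d < n} Φ_d, truncated at
-- degree n, so both facts rest on ∏_{d ∣ n} Φ_d = xⁿ − 1, proved by strong induction together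
-- with Φ_n(0) = ±1. In the induction step the Φ_d (d ∣ n, d < n) are pairwise coprime over ℚ,
-- because the ideal (xᵃ − 1, xᵇ − 1) contains x^g − 1 for a common divisor g of a and b; so
-- their product divides xⁿ − 1 in ℤ[x] and the truncated quotient is the exact one.
-- Φ_n(xᵖ) = Φ_{pn} for p ∣ n then follows by substituting xᵖ into ∏_{d ∣ n} Φ_d = xⁿ − 1 and
-- comparing with the factorisation of x^{pn} − 1.

module Submission where

open import Defs
open import Level using (0ℓ)
open import Algebra.Bundles using (CommutativeRing)
open import Data.Bool using (Bool; true; false; if_then_else_; _∧_; not; T)
import Data.Bool.Properties as Bool
open import Data.Integer as ℤ using (ℤ; +_; -_)
import Data.Integer.Properties as ℤ
open import Data.Integer.Tactic.RingSolver using () renaming (solve-∀ to solveℤ)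
open import Data.List
  using (List; []; _∷_; _++_; map; foldr; zipWith; drop; length; reverse; replicate; upTo; filterᵇ; applyUpTo; applyDownFrom)
import Data.List.Properties as List
open import Data.List.Membership.Propositional using (_∈_)
import Data.List.Membership.Propositional.Properties as ∈
open import Data.List.Relation.Unary.All using (All; []; _∷_)
import Data.List.Relation.Unary.All as All
import Data.List.Relation.Unary.All.Properties as All
open import Data.List.Relation.Unary.Any using (here; there)
open import Data.Maybe using (Maybe; just; nothing)
open import Data.Nat as ℕ using (ℕ; zero; suc; _<_; _≤_; _≤?_; z≤n; s≤s; _∸_; _⊔_; _≡ᵇ_; _/_)
import Data.Nat.Properties as ℕ
open import Data.Nat.Coprimality using (Coprime; coprime-divisor)
open import Data.Nat.Divisibility
  using (_∣_; _∣?_; divides; ∣-refl; ∣-trans; ∣⇒≤; ∣-antisym; ∣m∸n∣n⇒∣m; ∣m+n∣m⇒∣n; m∣m*n; n∣m*n; *-monoʳ-∣; *-cancelˡ-∣; *-pres-∣; 1∣_)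
open import Data.Nat.DivMod using (n/n≡1; m*n/n≡m)
open import Data.Nat.GCD using (gcd; gcd[m,n]∣m; gcd[m,n]∣n; gcd[m,n]≢0; gcd-zeroˡ)
open import Data.Nat.Induction using (<-rec)
open import Data.Nat.ListAction using (product)
open import Data.Nat.Primality using (Prime; prime⇒irreducible; prime⇒nonZero; prime⇒nonTrivial)
open import Data.Nat.Primality.Factorisation using (factorise)
open import Data.Nat.Tactic.RingSolver using () renaming (solve-∀ to solveℕ)
open import Data.Product using (∃; ∃₂; ∃-syntax; _×_; _,_; proj₁; proj₂; map₂)
open import Data.Sum using (_⊎_; inj₁; inj₂)
open import Function using (id; _∘_; _⇔_; Equivalence; mk⇔)
open import Relation.Binary.Bundles using (Setoid)
open import Relation.Binary.PropositionalEquality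
import Relation.Binary.Reasoning.Setoid as SetoidReasoning
open import Relation.Binary.Structures using (IsEquivalence)
open import Relation.Nullary using (¬_; yes; no; contradiction)
open import Relation.Nullary.Decidable using (⌊_⌋; T?; toWitness; _×-dec_)
open import Tactic.RingSolver using (solve-∀)
import Tactic.RingSolver.Core.AlmostCommutativeRing as ACR

-- ℤ[x] as coefficient lists up to trailing zeros

infix 4 _≋_
record _≋_ (p q : Poly) : Set where
  constructor mk≋
  field at : ∀ k → coeff p k ≡ coeff q k
open _≋_ public

≋-refl : ∀ {p} → p ≋ p
≋-refl = mk≋ λ _ → refl

≋-sym : ∀ {p q} → p ≋ q → q ≋ p
≋-sym e = mk≋ λ k → sym (at e k)

≋-trans : ∀ {p q r} → p ≋ q → q ≋ r → p ≋ r
≋-trans e f = mk≋ λ k → trans (at e k) (at f k)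

≡⇒≋ : ∀ {p q} → p ≡ q → p ≋ q
≡⇒≋ refl = ≋-refl

≋-isEquivalence : IsEquivalence _≋_
≋-isEquivalence = record { refl = ≋-refl ; sym = ≋-sym ; trans = ≋-trans }

≋-setoid : Setoid 0ℓ 0ℓ
≋-setoid = record { isEquivalence = ≋-isEquivalence }

module ≋-Reasoning = SetoidReasoning ≋-setoid

∷-cong : ∀ {a b p q} → a ≡ b → p ≋ q → (a ∷ p) ≋ (b ∷ q)
∷-cong a≡b p≋q = mk≋ λ { zero → a≡b ; (suc k) → at p≋q k }

∷-injective : ∀ {a b p q} → (a ∷ p) ≋ (b ∷ q) → a ≡ b × p ≋ q
∷-injective e = at e 0 , mk≋ λ k → at e (suc k)

shift : Poly → Poly
shift p = + 0 ∷ p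

neg : Poly → Poly
neg = scale (- + 1)

coeff-⊕ : ∀ p q k → coeff (p ⊕ q) k ≡ coeff p k ℤ.+ coeff q k
coeff-⊕ []      q       k       = sym (ℤ.+-identityˡ _)
coeff-⊕ (a ∷ p) []      k       = sym (ℤ.+-identityʳ _)
coeff-⊕ (a ∷ p) (b ∷ q) zero    = refl
coeff-⊕ (a ∷ p) (b ∷ q) (suc k) = coeff-⊕ p q k

coeff-scale : ∀ c p k → coeff (scale c p) k ≡ c ℤ.* coeff p k
coeff-scale c []      k       = sym (ℤ.*-zeroʳ c)
coeff-scale c (a ∷ p) zero    = refl
coeff-scale c (a ∷ p) (suc k) = coeff-scale c p k

shift-cong : ∀ {p q} → p ≋ q → shift p ≋ shift q
shift-cong = ∷-cong refl

⊕-cong : ∀ {p p′ q q′} → p ≋ p′ → q ≋ q′ → p ⊕ q ≋ p′ ⊕ q′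
⊕-cong {p} {p′} {q} {q′} e f = mk≋ λ k → begin
  coeff (p ⊕ q) k              ≡⟨ coeff-⊕ p q k ⟩
  coeff p k ℤ.+ coeff q k      ≡⟨ cong₂ ℤ._+_ (at e k) (at f k) ⟩
  coeff p′ k ℤ.+ coeff q′ k    ≡⟨ coeff-⊕ p′ q′ k ⟨
  coeff (p′ ⊕ q′) k            ∎
  where open ≡-Reasoning

⊕-congˡ : ∀ {p p′} q → p ≋ p′ → p ⊕ q ≋ p′ ⊕ q
⊕-congˡ q e = ⊕-cong e (≋-refl {q})

⊕-congʳ : ∀ p {q q′} → q ≋ q′ → p ⊕ q ≋ p ⊕ q′
⊕-congʳ p = ⊕-cong (≋-refl {p})

scale-cong : ∀ c {p q} → p ≋ q → scale c p ≋ scale c q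
scale-cong c {p} {q} e = mk≋ λ k → begin
  coeff (scale c p) k  ≡⟨ coeff-scale c p k ⟩
  c ℤ.* coeff p k      ≡⟨ cong (c ℤ.*_) (at e k) ⟩
  c ℤ.* coeff q k      ≡⟨ coeff-scale c q k ⟨
  coeff (scale c q) k  ∎
  where open ≡-Reasoning

⊕-identityʳ : ∀ p → p ⊕ [] ≋ p
⊕-identityʳ []      = ≋-refl
⊕-identityʳ (a ∷ p) = ≋-refl

⊕-comm : ∀ p q → p ⊕ q ≋ q ⊕ p
⊕-comm p q = mk≋ λ k → begin
  coeff (p ⊕ q) k          ≡⟨ coeff-⊕ p q k ⟩
  coeff p k ℤ.+ coeff q k  ≡⟨ ℤ.+-comm (coeff p k) (coeff q k) ⟩
  coeff q k ℤ.+ coeff p k  ≡⟨ coeff-⊕ q p k ⟨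
  coeff (q ⊕ p) k          ∎
  where open ≡-Reasoning

⊕-assoc : ∀ p q r → (p ⊕ q) ⊕ r ≋ p ⊕ (q ⊕ r)
⊕-assoc p q r = mk≋ λ k → begin
  coeff ((p ⊕ q) ⊕ r) k                       ≡⟨ coeff-⊕ (p ⊕ q) r k ⟩
  coeff (p ⊕ q) k ℤ.+ coeff r k               ≡⟨ cong (ℤ._+ coeff r k) (coeff-⊕ p q k) ⟩
  (coeff p k ℤ.+ coeff q k) ℤ.+ coeff r k     ≡⟨ ℤ.+-assoc (coeff p k) (coeff q k) (coeff r k) ⟩
  coeff p k ℤ.+ (coeff q k ℤ.+ coeff r k)     ≡⟨ cong (ℤ._+_ (coeff p k)) (coeff-⊕ q r k) ⟨
  coeff p k ℤ.+ coeff (q ⊕ r) k               ≡⟨ coeff-⊕ p (q ⊕ r) k ⟨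
  coeff (p ⊕ (q ⊕ r)) k                       ∎
  where open ≡-Reasoning

⊕-inverseˡ : ∀ p → neg p ⊕ p ≋ []
⊕-inverseˡ p = mk≋ λ k → begin
  coeff (neg p ⊕ p) k                    ≡⟨ coeff-⊕ (neg p) p k ⟩
  coeff (neg p) k ℤ.+ coeff p k          ≡⟨ cong (ℤ._+ coeff p k) (coeff-scale (- + 1) p k) ⟩
  - + 1 ℤ.* coeff p k ℤ.+ coeff p k      ≡⟨ cong (ℤ._+ coeff p k) (ℤ.-1*i≡-i (coeff p k)) ⟩
  ℤ.- coeff p k ℤ.+ coeff p k            ≡⟨ ℤ.+-inverseˡ (coeff p k) ⟩
  + 0                                    ∎
  where open ≡-Reasoning

⊕-interchange : ∀ a b c d → (a ⊕ b) ⊕ (c ⊕ d) ≋ (a ⊕ c) ⊕ (b ⊕ d)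
⊕-interchange a b c d = mk≋ λ k → begin
  coeff ((a ⊕ b) ⊕ (c ⊕ d)) k
    ≡⟨ coeff-⊕ (a ⊕ b) (c ⊕ d) k ⟩
  coeff (a ⊕ b) k ℤ.+ coeff (c ⊕ d) k
    ≡⟨ cong₂ ℤ._+_ (coeff-⊕ a b k) (coeff-⊕ c d k) ⟩
  (coeff a k ℤ.+ coeff b k) ℤ.+ (coeff c k ℤ.+ coeff d k)
    ≡⟨ interchange (coeff a k) (coeff b k) (coeff c k) (coeff d k) ⟩
  (coeff a k ℤ.+ coeff c k) ℤ.+ (coeff b k ℤ.+ coeff d k)
    ≡⟨ cong₂ ℤ._+_ (coeff-⊕ a c k) (coeff-⊕ b d k) ⟨
  coeff (a ⊕ c) k ℤ.+ coeff (b ⊕ d) k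
    ≡⟨ coeff-⊕ (a ⊕ c) (b ⊕ d) k ⟨
  coeff ((a ⊕ c) ⊕ (b ⊕ d)) k ∎
  where
  open ≡-Reasoning
  interchange : ∀ w x y z → (w ℤ.+ x) ℤ.+ (y ℤ.+ z) ≡ (w ℤ.+ y) ℤ.+ (x ℤ.+ z)
  interchange = solveℤ

scale-⊕ : ∀ c p q → scale c (p ⊕ q) ≋ scale c p ⊕ scale c q
scale-⊕ c p q = mk≋ λ k → begin
  coeff (scale c (p ⊕ q)) k                     ≡⟨ coeff-scale c (p ⊕ q) k ⟩
  c ℤ.* coeff (p ⊕ q) k                         ≡⟨ cong (c ℤ.*_) (coeff-⊕ p q k) ⟩
  c ℤ.* (coeff p k ℤ.+ coeff q k)               ≡⟨ ℤ.*-distribˡ-+ c (coeff p k) (coeff q k) ⟩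
  c ℤ.* coeff p k ℤ.+ c ℤ.* coeff q k           ≡⟨ cong₂ ℤ._+_ (coeff-scale c p k) (coeff-scale c q k) ⟨
  coeff (scale c p) k ℤ.+ coeff (scale c q) k   ≡⟨ coeff-⊕ (scale c p) (scale c q) k ⟨
  coeff (scale c p ⊕ scale c q) k               ∎
  where open ≡-Reasoning

scale-+ : ∀ a b p → scale (a ℤ.+ b) p ≋ scale a p ⊕ scale b p
scale-+ a b p = mk≋ λ k → begin
  coeff (scale (a ℤ.+ b) p) k                   ≡⟨ coeff-scale (a ℤ.+ b) p k ⟩
  (a ℤ.+ b) ℤ.* coeff p k                       ≡⟨ ℤ.*-distribʳ-+ (coeff p k) a b ⟩
  a ℤ.* coeff p k ℤ.+ b ℤ.* coeff p k           ≡⟨ cong₂ ℤ._+_ (coeff-scale a p k) (coeff-scale b p k) ⟨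
  coeff (scale a p) k ℤ.+ coeff (scale b p) k   ≡⟨ coeff-⊕ (scale a p) (scale b p) k ⟨
  coeff (scale a p ⊕ scale b p) k               ∎
  where open ≡-Reasoning

scale-scale : ∀ a b p → scale a (scale b p) ≋ scale (a ℤ.* b) p
scale-scale a b p = mk≋ λ k → begin
  coeff (scale a (scale b p)) k   ≡⟨ coeff-scale a (scale b p) k ⟩
  a ℤ.* coeff (scale b p) k       ≡⟨ cong (a ℤ.*_) (coeff-scale b p k) ⟩
  a ℤ.* (b ℤ.* coeff p k)         ≡⟨ ℤ.*-assoc a b (coeff p k) ⟨
  a ℤ.* b ℤ.* coeff p k           ≡⟨ coeff-scale (a ℤ.* b) p k ⟨
  coeff (scale (a ℤ.* b) p) k     ∎
  where open ≡-Reasoning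

scale-identity : ∀ p → scale (+ 1) p ≋ p
scale-identity p = mk≋ λ k → trans (coeff-scale (+ 1) p k) (ℤ.*-identityˡ _)

scale-zero : ∀ p → scale (+ 0) p ≋ []
scale-zero p = mk≋ λ k → trans (coeff-scale (+ 0) p k) (ℤ.*-zeroˡ (coeff p k))

scale-shift : ∀ c p → scale c (shift p) ≋ shift (scale c p)
scale-shift c p = ∷-cong (ℤ.*-zeroʳ c) ≋-refl

shift-zero : ∀ {p} → p ≋ [] → shift p ≋ []
shift-zero e = mk≋ λ { zero → refl ; (suc k) → at e k }

⊗-zeroʳ : ∀ p → p ⊗ [] ≋ []
⊗-zeroʳ []      = ≋-refl
⊗-zeroʳ (a ∷ p) = shift-zero (⊗-zeroʳ p)

⊗-zeroˡ : ∀ {p} q → p ≋ [] → p ⊗ q ≋ []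
⊗-zeroˡ {[]}    q e = ≋-refl
⊗-zeroˡ {a ∷ p} q e = begin
  scale a q ⊕ shift (p ⊗ q)   ≈⟨ ⊕-cong (≋-trans (≡⇒≋ (cong (λ c → scale c q) (at e 0))) (scale-zero q))
                                        (shift-zero (⊗-zeroˡ {p} q (mk≋ λ k → at e (suc k)))) ⟩
  []                          ∎
  where open ≋-Reasoning

⊗-congˡ : ∀ {p p′} q → p ≋ p′ → p ⊗ q ≋ p′ ⊗ q
⊗-congˡ {[]}    q e = ≋-sym (⊗-zeroˡ q (≋-sym e))
⊗-congˡ {a ∷ p} {[]}     q e = ⊗-zeroˡ q e
⊗-congˡ {a ∷ p} {b ∷ p′} q e =
  ⊕-cong (≡⇒≋ (cong (λ c → scale c q) (proj₁ (∷-injective e))))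
         (shift-cong (⊗-congˡ q (proj₂ (∷-injective e))))

⊗-congʳ : ∀ p {q q′} → q ≋ q′ → p ⊗ q ≋ p ⊗ q′
⊗-congʳ []      e = ≋-refl
⊗-congʳ (a ∷ p) e = ⊕-cong (scale-cong a e) (shift-cong (⊗-congʳ p e))

⊗-cong : ∀ {p p′ q q′} → p ≋ p′ → q ≋ q′ → p ⊗ q ≋ p′ ⊗ q′
⊗-cong {p′ = p′} {q = q} e f = ≋-trans (⊗-congˡ q e) (⊗-congʳ p′ f)

shift-⊗ˡ : ∀ p q → shift p ⊗ q ≋ shift (p ⊗ q)
shift-⊗ˡ p q = ⊕-congˡ (shift (p ⊗ q)) (scale-zero q)

⊗-distribʳ : ∀ p p′ q → (p ⊕ p′) ⊗ q ≋ (p ⊗ q) ⊕ (p′ ⊗ q)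
⊗-distribʳ []      p′       q = ≋-refl
⊗-distribʳ (a ∷ p) []       q = ≋-sym (⊕-identityʳ _)
⊗-distribʳ (a ∷ p) (b ∷ p′) q = begin
  scale (a ℤ.+ b) q ⊕ shift ((p ⊕ p′) ⊗ q)
    ≈⟨ ⊕-cong (scale-+ a b q) (shift-cong (⊗-distribʳ p p′ q)) ⟩
  (scale a q ⊕ scale b q) ⊕ (shift (p ⊗ q) ⊕ shift (p′ ⊗ q))
    ≈⟨ ⊕-interchange (scale a q) (scale b q) (shift (p ⊗ q)) (shift (p′ ⊗ q)) ⟩
  (scale a q ⊕ shift (p ⊗ q)) ⊕ (scale b q ⊕ shift (p′ ⊗ q))
    ∎
  where open ≋-Reasoning

scale-⊗ˡ : ∀ c p q → scale c p ⊗ q ≋ scale c (p ⊗ q)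
scale-⊗ˡ c []      q = ≋-refl
scale-⊗ˡ c (a ∷ p) q = begin
  scale (c ℤ.* a) q ⊕ shift (scale c p ⊗ q)
    ≈⟨ ⊕-cong (≋-sym (scale-scale c a q)) (shift-cong (scale-⊗ˡ c p q)) ⟩
  scale c (scale a q) ⊕ shift (scale c (p ⊗ q))
    ≈⟨ ⊕-congʳ (scale c (scale a q)) (≋-sym (scale-shift c (p ⊗ q))) ⟩
  scale c (scale a q) ⊕ scale c (shift (p ⊗ q))
    ≈⟨ scale-⊕ c (scale a q) (shift (p ⊗ q)) ⟨
  scale c (scale a q ⊕ shift (p ⊗ q))
    ∎
  where open ≋-Reasoning

⊗-assoc : ∀ p q r → (p ⊗ q) ⊗ r ≋ p ⊗ (q ⊗ r)
⊗-assoc []      q r = ≋-refl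
⊗-assoc (a ∷ p) q r = begin
  (scale a q ⊕ shift (p ⊗ q)) ⊗ r             ≈⟨ ⊗-distribʳ (scale a q) (shift (p ⊗ q)) r ⟩
  (scale a q ⊗ r) ⊕ (shift (p ⊗ q) ⊗ r)       ≈⟨ ⊕-cong (scale-⊗ˡ a q r) (shift-⊗ˡ (p ⊗ q) r) ⟩
  scale a (q ⊗ r) ⊕ shift ((p ⊗ q) ⊗ r)       ≈⟨ ⊕-congʳ (scale a (q ⊗ r)) (shift-cong (⊗-assoc p q r)) ⟩
  scale a (q ⊗ r) ⊕ shift (p ⊗ (q ⊗ r))       ∎
  where open ≋-Reasoning

⊗-distribˡ : ∀ p q q′ → p ⊗ (q ⊕ q′) ≋ (p ⊗ q) ⊕ (p ⊗ q′)
⊗-distribˡ []      q q′ = ≋-refl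
⊗-distribˡ (a ∷ p) q q′ = begin
  scale a (q ⊕ q′) ⊕ shift (p ⊗ (q ⊕ q′))
    ≈⟨ ⊕-cong (scale-⊕ a q q′) (shift-cong (⊗-distribˡ p q q′)) ⟩
  (scale a q ⊕ scale a q′) ⊕ (shift (p ⊗ q) ⊕ shift (p ⊗ q′))
    ≈⟨ ⊕-interchange (scale a q) (scale a q′) (shift (p ⊗ q)) (shift (p ⊗ q′)) ⟩
  (scale a q ⊕ shift (p ⊗ q)) ⊕ (scale a q′ ⊕ shift (p ⊗ q′))
    ∎
  where open ≋-Reasoning

⊗-shiftʳ : ∀ p q → p ⊗ shift q ≋ shift (p ⊗ q)
⊗-shiftʳ []      q = ≋-sym (shift-zero ≋-refl)
⊗-shiftʳ (a ∷ p) q = ⊕-cong (scale-shift a q) (shift-cong (⊗-shiftʳ p q))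

⊗-constʳ : ∀ p c → p ⊗ (c ∷ []) ≋ scale c p
⊗-constʳ []      c = ≋-refl
⊗-constʳ (a ∷ p) c = ∷-cong (trans (ℤ.+-identityʳ _) (ℤ.*-comm a c)) (⊗-constʳ p c)

∷-split : ∀ a p → a ∷ p ≋ (a ∷ []) ⊕ shift p
∷-split a p = ∷-cong (sym (ℤ.+-identityʳ a)) ≋-refl

⊗-comm : ∀ p q → p ⊗ q ≋ q ⊗ p
⊗-comm []      q = ≋-sym (⊗-zeroʳ q)
⊗-comm (a ∷ p) q = begin
  scale a q ⊕ shift (p ⊗ q)
    ≈⟨ ⊕-cong (⊗-constʳ q a) (≋-trans (⊗-shiftʳ q p) (shift-cong (⊗-comm q p))) ⟨
  (q ⊗ (a ∷ [])) ⊕ (q ⊗ shift p)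
    ≈⟨ ⊗-distribˡ q (a ∷ []) (shift p) ⟨
  q ⊗ ((a ∷ []) ⊕ shift p)
    ≈⟨ ⊗-congʳ q (∷-split a p) ⟨
  q ⊗ (a ∷ p) ∎
  where open ≋-Reasoning

⊗-identityˡ : ∀ p → one ⊗ p ≋ p
⊗-identityˡ p = ≋-trans (⊕-congʳ (scale (+ 1) p) (shift-zero ≋-refl))
                        (≋-trans (⊕-identityʳ (scale (+ 1) p)) (scale-identity p))

⊗-scaleʳ : ∀ c p q → p ⊗ scale c q ≋ scale c (p ⊗ q)
⊗-scaleʳ c p q = ≋-trans (⊗-comm p (scale c q)) (≋-trans (scale-⊗ˡ c q p) (scale-cong c (⊗-comm q p)))

⊗-identityʳ : ∀ p → p ⊗ one ≋ p
⊗-identityʳ p = ≋-trans (⊗-comm p one) (⊗-identityˡ p)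

polyRing : CommutativeRing 0ℓ 0ℓ
polyRing = record
  { Carrier = Poly ; _≈_ = _≋_ ; _+_ = _⊕_ ; _*_ = _⊗_ ; -_ = neg ; 0# = [] ; 1# = one
  ; isCommutativeRing = record
    { isRing = record
      { +-isAbelianGroup = record
        { isGroup = record
          { isMonoid = record
            { isSemigroup = record
              { isMagma = record { isEquivalence = ≋-isEquivalence ; ∙-cong = ⊕-cong }
              ; assoc = ⊕-assoc }
            ; identity = (λ _ → ≋-refl) , ⊕-identityʳ }
          ; inverse = ⊕-inverseˡ , λ p → ≋-trans (⊕-comm p (neg p)) (⊕-inverseˡ p)
          ; ⁻¹-cong = scale-cong (- + 1) }
        ; comm = ⊕-comm }
      ; *-cong = ⊗-cong
      ; *-assoc = ⊗-assoc
      ; *-identity = ⊗-identityˡ , ⊗-identityʳ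
      ; distrib = ⊗-distribˡ , λ p q q′ → ⊗-distribʳ q q′ p }
    ; *-comm = ⊗-comm } }

polyACR : ACR.AlmostCommutativeRing 0ℓ 0ℓ
polyACR = ACR.fromCommutativeRing polyRing ≋[]?
  where
  ≋[]? : ∀ p → Maybe ([] ≋ p)
  ≋[]? []      = just ≋-refl
  ≋[]? (a ∷ p) with a ℤ.≟ + 0 | ≋[]? p
  ... | yes a≡0 | just 0≋p = just (mk≋ λ { zero → sym a≡0 ; (suc k) → at 0≋p k })
  ... | _       | _        = nothing

⊗-interchange : ∀ a b c d → (a ⊗ b) ⊗ (c ⊗ d) ≋ (a ⊗ c) ⊗ (b ⊗ d)
⊗-interchange = solve-∀ polyACR

height-≋[] : ∀ {q} → q ≋ [] → height q ≡ 0
height-≋[] {[]}    _ = refl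
height-≋[] {a ∷ q} e rewrite at e 0 = height-≋[] {q} (mk≋ λ k → at e (suc k))

height-cong : ∀ {p q} → p ≋ q → height p ≡ height q
height-cong {[]}    {q}     e = sym (height-≋[] (≋-sym e))
height-cong {a ∷ p} {[]}    e = height-≋[] e
height-cong {a ∷ p} {b ∷ q} e =
  cong₂ (λ x y → ℤ.∣ x ∣ ⊔ y) (at e 0) (height-cong {p} {q} (proj₂ (∷-injective e)))

-- Division by polynomials with constant term ±1

IsUnit : ℤ → Set
IsUnit c = c ℤ.* c ≡ + 1

IsUnit⇒≢0 : ∀ {c} → IsUnit c → c ≢ + 0
IsUnit⇒≢0 () refl

coeff₀-⊗ : ∀ p q → coeff (p ⊗ q) 0 ≡ coeff p 0 ℤ.* coeff q 0
coeff₀-⊗ []      q = refl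
coeff₀-⊗ (a ∷ p) q = trans (coeff-⊕ (scale a q) (shift (p ⊗ q)) 0) (trans (ℤ.+-identityʳ _) (coeff-scale a q 0))

IsUnit-* : ∀ {a b} → IsUnit a → IsUnit b → IsUnit (a ℤ.* b)
IsUnit-* {a} {b} a² b² = trans (rearrange a b) (cong₂ ℤ._*_ a² b²)
  where
  rearrange : ∀ a b → a ℤ.* b ℤ.* (a ℤ.* b) ≡ a ℤ.* a ℤ.* (b ℤ.* b)
  rearrange = solveℤ

IsUnit-coeff₀-⊗ : ∀ p q → IsUnit (coeff p 0) → IsUnit (coeff q 0) → IsUnit (coeff (p ⊗ q) 0)
IsUnit-coeff₀-⊗ p q p₀ q₀ rewrite coeff₀-⊗ p q = IsUnit-* {coeff p 0} {coeff q 0} p₀ q₀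

IsUnit-*-cancelˡ : ∀ {q a} → IsUnit q → q ℤ.* a ≡ ℤ.- + 1 → IsUnit a
IsUnit-*-cancelˡ {q} {a} q² qa≡-1 = begin
  a ℤ.* a                          ≡⟨ ℤ.*-identityˡ (a ℤ.* a) ⟨
  + 1 ℤ.* (a ℤ.* a)                ≡⟨ cong (ℤ._* (a ℤ.* a)) q² ⟨
  q ℤ.* q ℤ.* (a ℤ.* a)            ≡⟨ rearrange q a ⟩
  q ℤ.* a ℤ.* (q ℤ.* a)            ≡⟨ cong₂ ℤ._*_ qa≡-1 qa≡-1 ⟩
  + 1                              ∎
  where
  open ≡-Reasoning
  rearrange : ∀ q a → q ℤ.* q ℤ.* (a ℤ.* a) ≡ q ℤ.* a ℤ.* (q ℤ.* a)
  rearrange = solveℤ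

Degree≤ : ℕ → Poly → Set
Degree≤ n p = ∀ k → n < k → coeff p k ≡ + 0

dot : List ℤ → List ℤ → ℤ
dot xs ys = foldr ℤ._+_ (+ 0) (zipWith ℤ._*_ xs ys)

dot-scaleʳ : ∀ c xs ys → c ℤ.* dot xs ys ≡ dot xs (map (c ℤ.*_) ys)
dot-scaleʳ c []       ys       = ℤ.*-zeroʳ c
dot-scaleʳ c (x ∷ xs) []       = ℤ.*-zeroʳ c
dot-scaleʳ c (x ∷ xs) (y ∷ ys) =
  trans (ℤ.*-distribˡ-+ c (x ℤ.* y) (dot xs ys)) (cong₂ ℤ._+_ (swap c x y) (dot-scaleʳ c xs ys))
  where
  swap : ∀ c x y → c ℤ.* (x ℤ.* y) ≡ x ℤ.* (c ℤ.* y)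
  swap = solveℤ

applyDownFrom-cong : ∀ {f g : ℕ → ℤ} → (∀ k → f k ≡ g k) → ∀ n →
                     applyDownFrom f n ≡ applyDownFrom g n
applyDownFrom-cong f≗g zero    = refl
applyDownFrom-cong f≗g (suc n) = cong₂ _∷_ (f≗g n) (applyDownFrom-cong f≗g n)

coeff-applyUpTo-< : ∀ (f : ℕ → ℤ) {n k} → k < n → coeff (applyUpTo f n) k ≡ f k
coeff-applyUpTo-< f {suc n} {zero}  _         = refl
coeff-applyUpTo-< f {suc n} {suc k} (s≤s k<n) = coeff-applyUpTo-< (f ∘ suc) k<n

coeff-applyUpTo-≥ : ∀ (f : ℕ → ℤ) {n k} → n ≤ k → coeff (applyUpTo f n) k ≡ + 0
coeff-applyUpTo-≥ f {zero}           _         = refl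
coeff-applyUpTo-≥ f {suc n} {suc k} (s≤s n≤k) = coeff-applyUpTo-≥ (f ∘ suc) n≤k

coeff-≥-length : ∀ p {k} → length p ≤ k → coeff p k ≡ + 0
coeff-≥-length []               _       = refl
coeff-≥-length (a ∷ p) {suc k} (s≤s h) = coeff-≥-length p h

coeff-⊗-dot : ∀ L q k → coeff (L ⊗ q) k ≡ dot L (applyDownFrom (coeff q) (suc k))
coeff-⊗-dot []      q k = refl
coeff-⊗-dot (c ∷ L) q k =
  trans (coeff-⊕ (scale c q) (shift (L ⊗ q)) k) (cong₂ ℤ._+_ (coeff-scale c q k) (tail k))
  where
  tail : ∀ k → coeff (shift (L ⊗ q)) k ≡ dot L (applyDownFrom (coeff q) k)
  tail zero    = sym (dot-[]ʳ L)
    where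
    dot-[]ʳ : ∀ xs → dot xs [] ≡ + 0
    dot-[]ʳ []      = refl
    dot-[]ʳ (_ ∷ _) = refl
  tail (suc k) = coeff-⊗-dot L q k

coeff-⊗-recurrence : ∀ L q k →
  coeff (L ⊗ q) k ≡ coeff L 0 ℤ.* coeff q k ℤ.+ dot (drop 1 L) (applyDownFrom (coeff q) k)
coeff-⊗-recurrence []      q k = sym (ℤ.+-identityʳ (+ 0 ℤ.* coeff q k))
coeff-⊗-recurrence (c ∷ L) q k = coeff-⊗-dot (c ∷ L) q k

module SeriesQuotient (a L : Poly) where

  -- prefix k = [q_{k−1}, …, q₀] is the accumulator of divStep after k steps.
  next : ℕ → List ℤ → ℤ
  next k rev = coeff L 0 ℤ.* (coeff a k ℤ.- dot (drop 1 L) rev)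

  prefix : ℕ → List ℤ
  prefix zero    = []
  prefix (suc k) = next k (prefix k) ∷ prefix k

  quotientCoeff : ℕ → ℤ
  quotientCoeff k = next k (prefix k)

  prefix≡applyDownFrom : ∀ k → prefix k ≡ applyDownFrom quotientCoeff k
  prefix≡applyDownFrom zero    = refl
  prefix≡applyDownFrom (suc k) = cong (quotientCoeff k ∷_) (prefix≡applyDownFrom k)

  length-prefix : ∀ k → length (prefix k) ≡ k
  length-prefix zero    = refl
  length-prefix (suc k) = cong suc (length-prefix k)

  divStep-prefix : ∀ r k → divStep a L r (prefix k) ≡ prefix (r ℕ.+ k)
  divStep-prefix zero    k = refl
  divStep-prefix (suc r) k rewrite length-prefix k =
    trans (divStep-prefix r (suc k)) (cong prefix (ℕ.+-suc r k))

  divP≡applyUpTo : ∀ N → divP a L N ≡ applyUpTo quotientCoeff (suc N)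
  divP≡applyUpTo N = begin
    reverse (divStep a L (suc N) [])              ≡⟨ cong reverse (divStep-prefix (suc N) 0) ⟩
    reverse (prefix (suc N ℕ.+ 0))                ≡⟨ cong (reverse ∘ prefix) (ℕ.+-identityʳ (suc N)) ⟩
    reverse (prefix (suc N))                      ≡⟨ cong reverse (prefix≡applyDownFrom (suc N)) ⟩
    reverse (applyDownFrom quotientCoeff (suc N)) ≡⟨ List.reverse-applyDownFrom quotientCoeff (suc N) ⟩
    applyUpTo quotientCoeff (suc N)               ∎
    where open ≡-Reasoning

  coeff-divP-≤ : ∀ N k → k ≤ N → coeff (divP a L N) k ≡ quotientCoeff k
  coeff-divP-≤ N k k≤N rewrite divP≡applyUpTo N = coeff-applyUpTo-< quotientCoeff (s≤s k≤N)

  coeff-divP-> : ∀ N k → N < k → coeff (divP a L N) k ≡ + 0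
  coeff-divP-> N k N<k rewrite divP≡applyUpTo N = coeff-applyUpTo-≥ quotientCoeff N<k

  module _ (unit : IsUnit (coeff L 0)) where

    private
      cancel-unit : ∀ q D → coeff L 0 ℤ.* ((coeff L 0 ℤ.* q ℤ.+ D) ℤ.- D) ≡ q
      cancel-unit q D = trans (rearrange (coeff L 0) q D) (trans (cong (ℤ._* q) unit) (ℤ.*-identityˡ q))
        where
        rearrange : ∀ u q D → u ℤ.* ((u ℤ.* q ℤ.+ D) ℤ.- D) ≡ u ℤ.* u ℤ.* q
        rearrange = solveℤ

      restore-unit : ∀ x D → coeff L 0 ℤ.* (coeff L 0 ℤ.* (x ℤ.- D)) ℤ.+ D ≡ x
      restore-unit x D =
        trans (rearrange (coeff L 0) x D) (trans (cong (λ u → u ℤ.* (x ℤ.- D) ℤ.+ D) unit) (cancel x D))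
        where
        rearrange : ∀ u x D → u ℤ.* (u ℤ.* (x ℤ.- D)) ℤ.+ D ≡ u ℤ.* u ℤ.* (x ℤ.- D) ℤ.+ D
        rearrange = solveℤ
        cancel : ∀ x D → + 1 ℤ.* (x ℤ.- D) ℤ.+ D ≡ x
        cancel = solveℤ

    quotient-unique : ∀ q → L ⊗ q ≋ a → ∀ k → coeff q k ≡ quotientCoeff k
    quotient-unique q Lq≋a k = List.∷-injectiveˡ (agree (suc k))
      where
      agree : ∀ k → applyDownFrom (coeff q) k ≡ prefix k
      agree zero    = refl
      agree (suc k) = cong₂ _∷_ (sym step) (agree k)
        where
        D = dot (drop 1 L) (applyDownFrom (coeff q) k)
        step : quotientCoeff k ≡ coeff q k
        step = begin
          coeff L 0 ℤ.* (coeff a k ℤ.- dot (drop 1 L) (prefix k))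
            ≡⟨ cong (λ rev → coeff L 0 ℤ.* (coeff a k ℤ.- dot (drop 1 L) rev)) (agree k) ⟨
          coeff L 0 ℤ.* (coeff a k ℤ.- D)
            ≡⟨ cong (λ x → coeff L 0 ℤ.* (x ℤ.- D)) (trans (sym (at Lq≋a k)) (coeff-⊗-recurrence L q k)) ⟩
          coeff L 0 ℤ.* ((coeff L 0 ℤ.* coeff q k ℤ.+ D) ℤ.- D)
            ≡⟨ cancel-unit (coeff q k) D ⟩
          coeff q k ∎
          where open ≡-Reasoning

    quotient-exists : ∀ q → (∀ k → coeff q k ≡ quotientCoeff k) → L ⊗ q ≋ a
    quotient-exists q q≗quot = mk≋ coeffs
      where
      coeffs : ∀ k → coeff (L ⊗ q) k ≡ coeff a k
      coeffs k = begin
        coeff (L ⊗ q) k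
          ≡⟨ coeff-⊗-recurrence L q k ⟩
        coeff L 0 ℤ.* coeff q k ℤ.+ dot (drop 1 L) (applyDownFrom (coeff q) k)
          ≡⟨ cong₂ (λ x rev → coeff L 0 ℤ.* x ℤ.+ dot (drop 1 L) rev) (q≗quot k) prefix-q ⟩
        coeff L 0 ℤ.* quotientCoeff k ℤ.+ dot (drop 1 L) (prefix k)
          ≡⟨ restore-unit (coeff a k) (dot (drop 1 L) (prefix k)) ⟩
        coeff a k ∎
        where
        open ≡-Reasoning
        prefix-q : applyDownFrom (coeff q) k ≡ prefix k
        prefix-q = trans (applyDownFrom-cong q≗quot k) (sym (prefix≡applyDownFrom k))

    quotient-of-scaled : ∀ c W → scale c a ≋ L ⊗ W → ∀ k → c ℤ.* quotientCoeff k ≡ coeff W k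
    quotient-of-scaled c W ca≋LW k = List.∷-injectiveˡ (agree (suc k))
      where
      agree : ∀ k → map (c ℤ.*_) (prefix k) ≡ applyDownFrom (coeff W) k
      agree zero    = refl
      agree (suc k) = cong₂ _∷_ step (agree k)
        where
        D = dot (drop 1 L) (applyDownFrom (coeff W) k)
        scaled-dot : c ℤ.* dot (drop 1 L) (prefix k) ≡ D
        scaled-dot = trans (dot-scaleʳ c (drop 1 L) (prefix k)) (cong (dot (drop 1 L)) (agree k))
        distribute : ∀ c u x d → c ℤ.* (u ℤ.* (x ℤ.- d)) ≡ u ℤ.* (c ℤ.* x ℤ.- c ℤ.* d)
        distribute = solveℤ
        step : c ℤ.* quotientCoeff k ≡ coeff W k
        step = begin
          c ℤ.* (coeff L 0 ℤ.* (coeff a k ℤ.- dot (drop 1 L) (prefix k)))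
            ≡⟨ distribute c (coeff L 0) (coeff a k) (dot (drop 1 L) (prefix k)) ⟩
          coeff L 0 ℤ.* (c ℤ.* coeff a k ℤ.- c ℤ.* dot (drop 1 L) (prefix k))
            ≡⟨ cong₂ (λ x y → coeff L 0 ℤ.* (x ℤ.- y)) ca scaled-dot ⟩
          coeff L 0 ℤ.* ((coeff L 0 ℤ.* coeff W k ℤ.+ D) ℤ.- D)
            ≡⟨ cancel-unit (coeff W k) D ⟩
          coeff W k ∎
          where
          open ≡-Reasoning
          ca : c ℤ.* coeff a k ≡ coeff L 0 ℤ.* coeff W k ℤ.+ D
          ca = trans (sym (coeff-scale c a k)) (trans (at ca≋LW k) (coeff-⊗-recurrence L W k))

⊗-cancelˡ : ∀ L {X Y} → IsUnit (coeff L 0) → L ⊗ X ≋ L ⊗ Y → X ≋ Y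
⊗-cancelˡ L {X} {Y} unit LX≋LY = mk≋ λ k →
  trans (quotient-unique unit X LX≋LY k) (sym (quotient-unique unit Y ≋-refl k))
  where open SeriesQuotient (L ⊗ Y) L

divP-exact : ∀ {a q} L N → IsUnit (coeff L 0) → L ⊗ q ≋ a → Degree≤ N q → divP a L N ≋ q
divP-exact {a} {q} L N unit Lq≋a deg = mk≋ coeffs
  where
  open SeriesQuotient a L
  coeffs : ∀ k → coeff (divP a L N) k ≡ coeff q k
  coeffs k with k ℕ.≤? N
  ... | yes k≤N = trans (coeff-divP-≤ N k k≤N) (sym (quotient-unique unit q Lq≋a k))
  ... | no  k≰N = trans (coeff-divP-> N k (ℕ.≰⇒> k≰N)) (sym (deg k (ℕ.≰⇒> k≰N)))

-- In ℤ[x], L ∣ c·F does not give L ∣ F in general. It does when L(0) = ±1: the power-series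
-- quotient F / L then has integer coefficients, and it equals the polynomial W / c.
divides-of-scaled : ∀ {F W} L c → IsUnit (coeff L 0) → c ≢ + 0 → scale c F ≋ L ⊗ W →
                    ∃ λ q → L ⊗ q ≋ F
divides-of-scaled {F} {W} L c unit c≢0 cF≋LW = divP F L (length W) , quotient-exists unit _ coeffs
  where
  open SeriesQuotient F L
  coeffs : ∀ k → coeff (divP F L (length W)) k ≡ quotientCoeff k
  coeffs k with k ℕ.≤? length W
  ... | yes k≤N = coeff-divP-≤ (length W) k k≤N
  ... | no  k≰N
    with ℤ.i*j≡0⇒i≡0∨j≡0 c (trans (quotient-of-scaled unit c W cF≋LW k) (coeff-≥-length W (ℕ.<⇒≤ (ℕ.≰⇒> k≰N))))
  ...   | inj₁ c≡0 = contradiction c≡0 c≢0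
  ...   | inj₂ q≡0 = trans (coeff-divP-> (length W) k (ℕ.≰⇒> k≰N)) (sym q≡0)

≋[]-or-nonzero : ∀ p → p ≋ [] ⊎ ∃ λ j → coeff p j ≢ + 0
≋[]-or-nonzero []      = inj₁ ≋-refl
≋[]-or-nonzero (b ∷ p) with b ℤ.≟ + 0 | ≋[]-or-nonzero p
... | _        | inj₂ (j , pⱼ≢0) = inj₂ (suc j , pⱼ≢0)
... | yes b≡0  | inj₁ p≋0        = inj₁ (mk≋ λ { zero → b≡0 ; (suc j) → at p≋0 j })
... | no  b≢0  | inj₁ _          = inj₂ (0 , b≢0)

HasDegree : Poly → ℕ → Set
HasDegree p K = coeff p K ≢ + 0 × Degree≤ K p

has-degree-≥ : ∀ p {k} → coeff p k ≢ + 0 → ∃ λ K → k ≤ K × HasDegree p K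
has-degree-≥ []      p₀≢0 = contradiction refl p₀≢0
has-degree-≥ (a ∷ p) {suc k} pₖ≢0 with has-degree-≥ p pₖ≢0
... | K , k≤K , lead , above = suc K , s≤s k≤K , lead , λ { (suc j) (s≤s K<j) → above j K<j }
has-degree-≥ (a ∷ p) {zero}  a≢0 with ≋[]-or-nonzero p
... | inj₁ p≋0       = 0 , z≤n , a≢0 , λ { (suc j) _ → at p≋0 j }
... | inj₂ (j , pⱼ≢0) with has-degree-≥ p pⱼ≢0
...   | K , _ , lead , above = suc K , z≤n , lead , λ { (suc j) (s≤s K<j) → above j K<j }

coeff-⊗-leading : ∀ L q {J K} → HasDegree L J → HasDegree q K →
                  coeff (L ⊗ q) (J ℕ.+ K) ≡ coeff L J ℤ.* coeff q K
coeff-⊗-leading []      q         (L≢0 , _) _ = contradiction refl L≢0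
coeff-⊗-leading (c ∷ L) q {zero} {K} (_ , above) _ = begin
  coeff (scale c q ⊕ shift (L ⊗ q)) K           ≡⟨ at (⊕-congʳ (scale c q) (shift-zero (⊗-zeroˡ q L≋0))) K ⟩
  coeff (scale c q ⊕ []) K                      ≡⟨ at (⊕-identityʳ (scale c q)) K ⟩
  coeff (scale c q) K                           ≡⟨ coeff-scale c q K ⟩
  c ℤ.* coeff q K                               ∎
  where
  open ≡-Reasoning
  L≋0 : L ≋ []
  L≋0 = mk≋ λ j → above (suc j) (s≤s z≤n)
coeff-⊗-leading (c ∷ L) q {suc J} {K} (L≢0 , above) (q≢0 , q-above) = begin
  coeff (scale c q ⊕ shift (L ⊗ q)) (suc J ℕ.+ K)
    ≡⟨ coeff-⊕ (scale c q) (shift (L ⊗ q)) (suc J ℕ.+ K) ⟩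
  coeff (scale c q) (suc J ℕ.+ K) ℤ.+ coeff (L ⊗ q) (J ℕ.+ K)
    ≡⟨ cong (ℤ._+ coeff (L ⊗ q) (J ℕ.+ K)) beyond ⟩
  + 0 ℤ.+ coeff (L ⊗ q) (J ℕ.+ K)
    ≡⟨ ℤ.+-identityˡ _ ⟩
  coeff (L ⊗ q) (J ℕ.+ K)
    ≡⟨ coeff-⊗-leading L q (L≢0 , λ j J<j → above (suc j) (s≤s J<j)) (q≢0 , q-above) ⟩
  coeff L J ℤ.* coeff q K ∎
  where
  open ≡-Reasoning
  beyond : coeff (scale c q) (suc J ℕ.+ K) ≡ + 0
  beyond = trans (coeff-scale c q (suc J ℕ.+ K))
                 (trans (cong (c ℤ.*_) (q-above (suc J ℕ.+ K) (s≤s (ℕ.m≤n+m K J)))) (ℤ.*-zeroʳ c))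

Degree≤-cancelˡ : ∀ {n} L q → coeff L 0 ≢ + 0 → Degree≤ n (L ⊗ q) → Degree≤ n q
Degree≤-cancelˡ L q L₀≢0 deg k n<k with coeff q k ℤ.≟ + 0
... | yes qₖ≡0 = qₖ≡0
... | no  qₖ≢0 with has-degree-≥ q qₖ≢0 | has-degree-≥ L L₀≢0
...   | K , k≤K , q-deg | J , _ , L-deg =
  contradiction (trans (sym (coeff-⊗-leading L q L-deg q-deg)) (deg (J ℕ.+ K) n<J+K))
                (nonzero-product (proj₁ L-deg) (proj₁ q-deg))
  where
  n<J+K = ℕ.<-≤-trans n<k (ℕ.≤-trans k≤K (ℕ.m≤n+m K J))
  nonzero-product : ∀ {x y} → x ≢ + 0 → y ≢ + 0 → x ℤ.* y ≢ + 0
  nonzero-product {x} x≢0 y≢0 xy≡0 with ℤ.i*j≡0⇒i≡0∨j≡0 x xy≡0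
  ... | inj₁ x≡0 = x≢0 x≡0
  ... | inj₂ y≡0 = y≢0 y≡0

infix 6.5 _∣ᵇ_
_∣ᵇ_ : ℕ → ℕ → Bool
d ∣ᵇ n = ⌊ d ∣? n ⌋

∣ᵇ-true : ∀ {d n} → d ∣ n → (d ∣ᵇ n) ≡ true
∣ᵇ-true {d} {n} d∣n with d ∣? n
... | yes _   = refl
... | no  d∤n = contradiction d∣n d∤n

∣ᵇ-false : ∀ {d n} → ¬ d ∣ n → (d ∣ᵇ n) ≡ false
∣ᵇ-false {d} {n} d∤n with d ∣? n
... | yes d∣n = contradiction d∣n d∤n
... | no  _   = refl

∣ᵇ-cong : ∀ {a b c d} → a ∣ b ⇔ c ∣ d → (a ∣ᵇ b) ≡ (c ∣ᵇ d)
∣ᵇ-cong {a} {b} a∣b⇔c∣d with a ∣? b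
... | yes a∣b = sym (∣ᵇ-true (Equivalence.to a∣b⇔c∣d a∣b))
... | no  a∤b = sym (∣ᵇ-false (a∤b ∘ Equivalence.from a∣b⇔c∣d))

range : ℕ → List ℕ
range N = map suc (upTo N)

range-bounds : ∀ N → All (λ d → 1 ≤ d × d ≤ N) (range N)
range-bounds N = All.map⁺ (All.applyUpTo⁺₁ id N λ i<N → s≤s z≤n , i<N)

∈-range : ∀ {N d} → 1 ≤ d → d ≤ N → d ∈ range N
∈-range {N} {suc d} _ d<N = ∈.∈-map⁺ suc (∈.∈-upTo⁺ d<N)

range-suc : ∀ N → range (suc N) ≡ range N ++ (suc N ∷ [])
range-suc N = trans (cong (map suc) (sym (List.upTo-∷ʳ N))) (List.map-++ suc (upTo N) (N ∷ []))

prodP-++ : ∀ xs ys → prodP (xs ++ ys) ≋ prodP xs ⊗ prodP ys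
prodP-++ []       ys = ≋-sym (⊗-identityˡ (prodP ys))
prodP-++ (x ∷ xs) ys = ≋-trans (⊗-congʳ x (prodP-++ xs ys)) (≋-sym (⊗-assoc x (prodP xs) (prodP ys)))

factorIf : (ℕ → Poly) → (ℕ → Bool) → ℕ → Poly
factorIf F P d = if P d then F d else one

factorIf-true : ∀ F P {d} → P d ≡ true → factorIf F P d ≡ F d
factorIf-true F P P≡true rewrite P≡true = refl

∏≤ : (ℕ → Poly) → ℕ → (ℕ → Bool) → Poly
∏≤ F zero    P = one
∏≤ F (suc N) P = ∏≤ F N P ⊗ factorIf F P (suc N)

prodP-filter-range : ∀ F N P → prodP (map F (filterᵇ P (range N))) ≋ ∏≤ F N P
prodP-filter-range F zero    P = ≋-refl
prodP-filter-range F (suc N) P = begin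
  prodP (map F (filterᵇ P (range (suc N))))
    ≡⟨ cong (prodP ∘ map F ∘ filterᵇ P) (range-suc N) ⟩
  prodP (map F (filterᵇ P (range N ++ suc N ∷ [])))
    ≡⟨ cong (prodP ∘ map F) (List.filter-++ (T? ∘ P) (range N) (suc N ∷ [])) ⟩
  prodP (map F (filterᵇ P (range N) ++ filterᵇ P (suc N ∷ [])))
    ≡⟨ cong prodP (List.map-++ F (filterᵇ P (range N)) (filterᵇ P (suc N ∷ []))) ⟩
  prodP (map F (filterᵇ P (range N)) ++ map F (filterᵇ P (suc N ∷ [])))
    ≈⟨ prodP-++ (map F (filterᵇ P (range N))) (map F (filterᵇ P (suc N ∷ []))) ⟩
  prodP (map F (filterᵇ P (range N))) ⊗ prodP (map F (filterᵇ P (suc N ∷ [])))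
    ≈⟨ ⊗-cong (prodP-filter-range F N P) last ⟩
  ∏≤ F N P ⊗ factorIf F P (suc N)
    ∎
  where
  open ≋-Reasoning
  last : prodP (map F (filterᵇ P (suc N ∷ []))) ≋ factorIf F P (suc N)
  last with P (suc N)
  ... | true  = ⊗-identityʳ (F (suc N))
  ... | false = ≋-refl

∏≤-cong : ∀ {F G} N {P Q} → (∀ d → 1 ≤ d → d ≤ N → P d ≡ Q d) →
          (∀ d → 1 ≤ d → d ≤ N → P d ≡ true → F d ≋ G d) → ∏≤ F N P ≋ ∏≤ G N Q
∏≤-cong zero    P≗Q F≗G = ≋-refl
∏≤-cong {F} {G} (suc N) {P} {Q} P≗Q F≗G =
  ⊗-cong (∏≤-cong N (λ d 1≤d d≤N → P≗Q d 1≤d (ℕ.m≤n⇒m≤1+n d≤N))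
                    (λ d 1≤d d≤N → F≗G d 1≤d (ℕ.m≤n⇒m≤1+n d≤N)))
         last
  where
  last : factorIf F P (suc N) ≋ factorIf G Q (suc N)
  last with P (suc N) | Q (suc N) | P≗Q (suc N) (s≤s z≤n) ℕ.≤-refl | F≗G (suc N) (s≤s z≤n) ℕ.≤-refl
  ... | true  | true  | _ | F≋G = F≋G refl
  ... | false | false | _ | _   = ≋-refl

∏≤-trim : ∀ F {N M} P → N ≤ M → (∀ d → N < d → d ≤ M → P d ≡ false) → ∏≤ F M P ≋ ∏≤ F N P
∏≤-trim F {N} {zero}  P z≤n _ = ≋-refl
∏≤-trim F {N} {suc M} P N≤1+M none with ℕ.m≤n⇒m<n∨m≡n N≤1+M
... | inj₂ refl       = ≋-refl
... | inj₁ (s≤s N≤M) =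
  ≋-trans (⊗-cong (∏≤-trim F P N≤M (λ d N<d d≤M → none d N<d (ℕ.m≤n⇒m≤1+n d≤M))) last) (⊗-identityʳ _)
  where
  last : factorIf F P (suc M) ≋ one
  last rewrite none (suc M) (s≤s N≤M) ℕ.≤-refl = ≋-refl

∏≤-none : ∀ F N P → (∀ d → 1 ≤ d → d ≤ N → P d ≡ false) → ∏≤ F N P ≋ one
∏≤-none F N P none = ∏≤-trim F P z≤n none

∏≤-split : ∀ F N (P Q : ℕ → Bool) →
           ∏≤ F N P ≋ ∏≤ F N (λ d → P d ∧ Q d) ⊗ ∏≤ F N (λ d → P d ∧ not (Q d))
∏≤-split F zero    P Q = ≋-sym (⊗-identityˡ one)
∏≤-split F (suc N) P Q =
  ≋-trans (⊗-cong (∏≤-split F N P Q) last)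
          (⊗-interchange (∏≤ F N (λ d → P d ∧ Q d)) (∏≤ F N (λ d → P d ∧ not (Q d)))
                         (factorIf F (λ d → P d ∧ Q d) (suc N)) (factorIf F (λ d → P d ∧ not (Q d)) (suc N)))
  where
  last : factorIf F P (suc N) ≋
         factorIf F (λ d → P d ∧ Q d) (suc N) ⊗ factorIf F (λ d → P d ∧ not (Q d)) (suc N)
  last with P (suc N) | Q (suc N)
  ... | true  | true  = ≋-sym (⊗-identityʳ _)
  ... | true  | false = ≋-sym (⊗-identityˡ _)
  ... | false | _     = ≋-sym (⊗-identityˡ _)

∏≤-⊗ : ∀ F G N P → ∏≤ (λ d → F d ⊗ G d) N P ≋ ∏≤ F N P ⊗ ∏≤ G N P
∏≤-⊗ F G zero    P = ≋-sym (⊗-identityˡ one)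
∏≤-⊗ F G (suc N) P =
  ≋-trans (⊗-cong (∏≤-⊗ F G N P) last)
          (⊗-interchange (∏≤ F N P) (∏≤ G N P) (factorIf F P (suc N)) (factorIf G P (suc N)))
  where
  last : factorIf (λ d → F d ⊗ G d) P (suc N) ≋ factorIf F P (suc N) ⊗ factorIf G P (suc N)
  last with P (suc N)
  ... | true  = ≋-refl
  ... | false = ≋-sym (⊗-identityˡ one)

∏≤-∧ : ∀ F N (P Q : ℕ → Bool) → ∏≤ F N (λ d → P d ∧ Q d) ≋ ∏≤ (factorIf F Q) N P
∏≤-∧ F zero    P Q = ≋-refl
∏≤-∧ F (suc N) P Q = ⊗-cong (∏≤-∧ F N P Q) (≡⇒≋ last)
  where
  last : factorIf F (λ d → P d ∧ Q d) (suc N) ≡ factorIf (factorIf F Q) P (suc N)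
  last with P (suc N)
  ... | true  = refl
  ... | false = refl

IsUnit-coeff₀-∏≤ : ∀ F N P → (∀ d → 1 ≤ d → d ≤ N → IsUnit (coeff (F d) 0)) →
                   IsUnit (coeff (∏≤ F N P) 0)
IsUnit-coeff₀-∏≤ F zero    P units = refl
IsUnit-coeff₀-∏≤ F (suc N) P units =
  IsUnit-coeff₀-⊗ (∏≤ F N P) (factorIf F P (suc N))
    (IsUnit-coeff₀-∏≤ F N P (λ d 1≤d d≤N → units d 1≤d (ℕ.m≤n⇒m≤1+n d≤N))) last
  where
  last : IsUnit (coeff (factorIf F P (suc N)) 0)
  last with P (suc N)
  ... | true  = units (suc N) (s≤s z≤n) ℕ.≤-refl
  ... | false = refl

xpow : ℕ → Poly
xpow n = replicate n (+ 0) ++ (+ 1 ∷ [])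

xpow-+ : ∀ a b → xpow (a ℕ.+ b) ≋ xpow a ⊗ xpow b
xpow-+ zero    b = ≋-sym (⊗-identityˡ (xpow b))
xpow-+ (suc a) b = ≋-trans (shift-cong (xpow-+ a b)) (≋-sym (shift-⊗ˡ (xpow a) (xpow b)))

xn-1≋ : ∀ n → xn-1 n ≋ xpow n ⊕ neg one
xn-1≋ zero    = mk≋ λ { zero → refl ; (suc k) → refl }
xn-1≋ (suc n) = ∷-cong refl (≋-sym (⊕-identityʳ (xpow n)))

constP : ℕ → Poly
constP k = + k ∷ []

geometric : ℕ → ℕ → Poly
geometric g zero    = []
geometric g (suc k) = one ⊕ (xpow g ⊗ geometric g k)

geometric-sum : ∀ g k → xn-1 g ⊗ geometric g k ≋ xn-1 (g ℕ.* k)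
geometric-sum g zero    = ≋-trans (⊗-zeroʳ (xn-1 g)) (≡⇒≋ (cong xn-1 (sym (ℕ.*-zeroʳ g))))
geometric-sum g (suc k) = begin
  xn-1 g ⊗ (one ⊕ (xpow g ⊗ geometric g k))               ≈⟨ ⊗-congˡ _ (xn-1≋ g) ⟩
  (xpow g ⊕ neg one) ⊗ (one ⊕ (xpow g ⊗ geometric g k))   ≈⟨ telescope (xpow g) (geometric g k) ⟩
  (xpow g ⊗ ((xpow g ⊕ neg one) ⊗ geometric g k)) ⊕ (xpow g ⊕ neg one)
    ≈⟨ ⊕-congˡ _ (⊗-congʳ (xpow g) (≋-trans (⊗-congˡ _ (≋-sym (xn-1≋ g))) (geometric-sum g k))) ⟩
  (xpow g ⊗ xn-1 (g ℕ.* k)) ⊕ (xpow g ⊕ neg one)          ≈⟨ ⊕-congˡ _ (⊗-congʳ (xpow g) (xn-1≋ (g ℕ.* k))) ⟩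
  (xpow g ⊗ (xpow (g ℕ.* k) ⊕ neg one)) ⊕ (xpow g ⊕ neg one) ≈⟨ collapse (xpow g) (xpow (g ℕ.* k)) ⟩
  (xpow g ⊗ xpow (g ℕ.* k)) ⊕ neg one                     ≈⟨ ⊕-congˡ (neg one) (xpow-+ g (g ℕ.* k)) ⟨
  xpow (g ℕ.+ g ℕ.* k) ⊕ neg one                          ≈⟨ xn-1≋ (g ℕ.+ g ℕ.* k) ⟨
  xn-1 (g ℕ.+ g ℕ.* k)                                    ≡⟨ cong xn-1 (ℕ.*-suc g k) ⟨
  xn-1 (g ℕ.* suc k)                                      ∎
  where
  open ≋-Reasoning
  telescope : ∀ X G → (X ⊕ neg one) ⊗ (one ⊕ (X ⊗ G)) ≋ (X ⊗ ((X ⊕ neg one) ⊗ G)) ⊕ (X ⊕ neg one)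
  telescope = solve-∀ polyACR
  collapse : ∀ X Y → (X ⊗ (Y ⊕ neg one)) ⊕ (X ⊕ neg one) ≋ (X ⊗ Y) ⊕ neg one
  collapse = solve-∀ polyACR

geometric-mod : ∀ g k → ∃ λ W → geometric g k ≋ constP k ⊕ (xn-1 g ⊗ W)
geometric-mod g zero    = [] , ≋-sym (≋-trans (⊕-congʳ (constP 0) (⊗-zeroʳ (xn-1 g))) (shift-zero ≋-refl))
geometric-mod g (suc k) with geometric-mod g k
... | W , G≋k+XW = geometric g k ⊕ W , (begin
  one ⊕ (xpow g ⊗ G)
    ≈⟨ split (xpow g) G ⟩
  (one ⊕ ((xpow g ⊕ neg one) ⊗ G)) ⊕ G
    ≈⟨ ⊕-cong (⊕-congʳ one (⊗-congˡ G (≋-sym (xn-1≋ g)))) G≋k+XW ⟩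
  (one ⊕ (xn-1 g ⊗ G)) ⊕ (constP k ⊕ (xn-1 g ⊗ W))
    ≈⟨ regroup (constP k) (xn-1 g) G W ⟩
  (one ⊕ constP k) ⊕ (xn-1 g ⊗ (G ⊕ W))
    ≡⟨⟩
  constP (suc k) ⊕ (xn-1 g ⊗ (G ⊕ W)) ∎)
  where
  open ≋-Reasoning
  G = geometric g k
  split : ∀ X G → one ⊕ (X ⊗ G) ≋ (one ⊕ ((X ⊕ neg one) ⊗ G)) ⊕ G
  split = solve-∀ polyACR
  regroup : ∀ K Y G W → (one ⊕ (Y ⊗ G)) ⊕ (K ⊕ (Y ⊗ W)) ≋ (one ⊕ K) ⊕ (Y ⊗ (G ⊕ W))
  regroup = solve-∀ polyACR

xn-1-∸ : ∀ {a b} → a ≤ b → xn-1 (b ∸ a) ≋ xn-1 b ⊕ neg (xpow (b ∸ a) ⊗ xn-1 a)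
xn-1-∸ {a} {b} a≤b = begin
  xn-1 (b ∸ a)
    ≈⟨ xn-1≋ (b ∸ a) ⟩
  Y ⊕ neg one
    ≈⟨ cancel Y (xpow a) ⟩
  ((Y ⊗ xpow a) ⊕ neg one) ⊕ neg (Y ⊗ (xpow a ⊕ neg one))
    ≈⟨ ⊕-cong (⊕-congˡ (neg one) (xpow-+ (b ∸ a) a)) (scale-cong (- + 1) (⊗-congʳ Y (xn-1≋ a))) ⟨
  (xpow (b ∸ a ℕ.+ a) ⊕ neg one) ⊕ neg (Y ⊗ xn-1 a)
    ≡⟨ cong (λ n → (xpow n ⊕ neg one) ⊕ neg (Y ⊗ xn-1 a)) (ℕ.m∸n+n≡m a≤b) ⟩
  (xpow b ⊕ neg one) ⊕ neg (Y ⊗ xn-1 a)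
    ≈⟨ ⊕-congˡ _ (xn-1≋ b) ⟨
  xn-1 b ⊕ neg (Y ⊗ xn-1 a) ∎
  where
  open ≋-Reasoning
  Y = xpow (b ∸ a)
  cancel : ∀ Y X → Y ⊕ neg one ≋ ((Y ⊗ X) ⊕ neg one) ⊕ neg (Y ⊗ (X ⊕ neg one))
  cancel = solve-∀ polyACR

XBezout : ℕ → ℕ → Set
XBezout a b = ∃ λ g → g ∣ a × g ∣ b × ∃₂ λ U V → xn-1 g ≋ (U ⊗ xn-1 a) ⊕ (V ⊗ xn-1 b)

XBezout-swap : ∀ {a b} → XBezout a b → XBezout b a
XBezout-swap {a} {b} (g , g∣a , g∣b , U , V , e) =
  g , g∣b , g∣a , V , U , ≋-trans e (⊕-comm (U ⊗ xn-1 a) (V ⊗ xn-1 b))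

XBezout-∸ : ∀ {a b} → a ≤ b → XBezout a (b ∸ a) → XBezout a b
XBezout-∸ {a} {b} a≤b (g , g∣a , g∣b∸a , U , V , e) =
  g , g∣a , ∣m∸n∣n⇒∣m g a≤b g∣b∸a g∣a , U ⊕ neg (V ⊗ X) , V , (begin
    xn-1 g                                                 ≈⟨ e ⟩
    (U ⊗ xn-1 a) ⊕ (V ⊗ xn-1 (b ∸ a))                      ≈⟨ ⊕-congʳ (U ⊗ xn-1 a) (⊗-congʳ V (xn-1-∸ a≤b)) ⟩
    (U ⊗ xn-1 a) ⊕ (V ⊗ (xn-1 b ⊕ neg (X ⊗ xn-1 a)))       ≈⟨ regroup U V (xn-1 a) (xn-1 b) X ⟩
    ((U ⊕ neg (V ⊗ X)) ⊗ xn-1 a) ⊕ (V ⊗ xn-1 b)            ∎)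
  where
  open ≋-Reasoning
  X = xpow (b ∸ a)
  regroup : ∀ U V A B X → (U ⊗ A) ⊕ (V ⊗ (B ⊕ neg (X ⊗ A))) ≋ ((U ⊕ neg (V ⊗ X)) ⊗ A) ⊕ (V ⊗ B)
  regroup = solve-∀ polyACR

XBezout-zero : ∀ b → XBezout 0 b
XBezout-zero b = b , divides 0 refl , ∣-refl , [] , one , ≋-sym (⊗-identityˡ (xn-1 b))

xn-1-bezout : ∀ a b → XBezout a b
xn-1-bezout a b = euclid (a ℕ.+ b) a b ℕ.≤-refl
  where
  euclid : ∀ fuel a b → a ℕ.+ b ≤ fuel → XBezout a b
  euclid _            zero    b       _ = XBezout-zero b
  euclid _            (suc a) zero    _ = XBezout-swap (XBezout-zero (suc a))
  euclid (suc fuel) (suc a) (suc b) (s≤s a+1+b≤fuel) with ℕ.≤-total (suc a) (suc b)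
  ... | inj₁ a≤b =
    XBezout-∸ a≤b (euclid fuel (suc a) (suc b ∸ suc a) (subst (_≤ fuel) (sym (ℕ.m+[n∸m]≡n a≤b)) b≤fuel))
    where b≤fuel = ℕ.≤-trans (ℕ.m≤n+m (suc b) a) a+1+b≤fuel
  ... | inj₂ b≤a =
    XBezout-swap (XBezout-∸ b≤a (euclid fuel (suc b) (suc a ∸ suc b) (subst (_≤ fuel) (sym (ℕ.m+[n∸m]≡n b≤a)) a≤fuel)))
    where a≤fuel = ℕ.≤-trans (s≤s (ℕ.m≤m+n a b)) (subst (_≤ fuel) (ℕ.+-suc a b) a+1+b≤fuel)

xn-1-degree : ∀ n → Degree≤ n (xn-1 n)
xn-1-degree zero    _ _ = refl
xn-1-degree (suc n) (suc k) (s≤s n<k) = xpow-degree n k n<k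
  where
  xpow-degree : ∀ n → Degree≤ n (xpow n)
  xpow-degree zero    (suc k) _         = refl
  xpow-degree (suc n) (suc k) (s≤s n<k) = xpow-degree n k n<k

-- Coprimality over ℚ

Coprimeℚ : Poly → Poly → Set
Coprimeℚ X Y = ∃ λ c → ∃₂ λ s t → constP (suc c) ≋ (s ⊗ X) ⊕ (t ⊗ Y)

Coprimeℚ-sym : ∀ {X Y} → Coprimeℚ X Y → Coprimeℚ Y X
Coprimeℚ-sym {X} {Y} (c , s , t , e) = c , t , s , ≋-trans e (⊕-comm (s ⊗ X) (t ⊗ Y))

Coprimeℚ-oneˡ : ∀ Y → Coprimeℚ one Y
Coprimeℚ-oneˡ Y = 0 , one , [] , ≋-refl

Coprimeℚ-divisorʳ : ∀ {X Y W} Z → Coprimeℚ X Y → Y ≋ Z ⊗ W → Coprimeℚ X W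
Coprimeℚ-divisorʳ {X} {Y} {W} Z (c , s , t , e) Y≋ZW =
  c , s , t ⊗ Z , ≋-trans e (⊕-congʳ (s ⊗ X) (≋-trans (⊗-congʳ t Y≋ZW) (≋-sym (⊗-assoc t Z W))))

Coprimeℚ-⊗ˡ : ∀ {X Y Z} → Coprimeℚ X Z → Coprimeℚ Y Z → Coprimeℚ (X ⊗ Y) Z
Coprimeℚ-⊗ˡ {X} {Y} {Z} (c , s , t , e) (c′ , s′ , t′ , e′) =
  c′ ℕ.+ c ℕ.* suc c′ , s ⊗ s′ , (t ⊗ ((s′ ⊗ Y) ⊕ (t′ ⊗ Z))) ⊕ ((s ⊗ X) ⊗ t′) , (begin
    constP (suc c ℕ.* suc c′)
      ≈⟨ ∷-cong (trans (ℤ.pos-* (suc c) (suc c′)) (sym (ℤ.+-identityʳ _))) ≋-refl ⟩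
    constP (suc c) ⊗ constP (suc c′)
      ≈⟨ ⊗-cong e e′ ⟩
    ((s ⊗ X) ⊕ (t ⊗ Z)) ⊗ ((s′ ⊗ Y) ⊕ (t′ ⊗ Z))
      ≈⟨ expand s t s′ t′ X Y Z ⟩
    ((s ⊗ s′) ⊗ (X ⊗ Y)) ⊕ (((t ⊗ ((s′ ⊗ Y) ⊕ (t′ ⊗ Z))) ⊕ ((s ⊗ X) ⊗ t′)) ⊗ Z) ∎)
  where
  open ≋-Reasoning
  expand : ∀ s t s′ t′ X Y Z → ((s ⊗ X) ⊕ (t ⊗ Z)) ⊗ ((s′ ⊗ Y) ⊕ (t′ ⊗ Z)) ≋
           ((s ⊗ s′) ⊗ (X ⊗ Y)) ⊕ (((t ⊗ ((s′ ⊗ Y) ⊕ (t′ ⊗ Z))) ⊕ ((s ⊗ X) ⊗ t′)) ⊗ Z)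
  expand = solve-∀ polyACR

Coprimeℚ-lcm : ∀ {X Y P A B} → Coprimeℚ X Y → IsUnit (coeff X 0) → IsUnit (coeff Y 0) →
               P ≋ X ⊗ A → P ≋ Y ⊗ B → ∃ λ C → P ≋ (X ⊗ Y) ⊗ C
Coprimeℚ-lcm {X} {Y} {P} {A} {B} (c , s , t , e) X₀ Y₀ P≋XA P≋YB =
  map₂ ≋-sym (divides-of-scaled (X ⊗ Y) (+ suc c) (IsUnit-coeff₀-⊗ X Y X₀ Y₀) (λ ()) cP≋XY[sB+tA])
  where
  cP≋XY[sB+tA] : scale (+ suc c) P ≋ (X ⊗ Y) ⊗ ((s ⊗ B) ⊕ (t ⊗ A))
  cP≋XY[sB+tA] = begin
    scale (+ suc c) P                        ≈⟨ ⊗-constʳ P (+ suc c) ⟨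
    P ⊗ constP (suc c)                       ≈⟨ ⊗-congʳ P e ⟩
    P ⊗ ((s ⊗ X) ⊕ (t ⊗ Y))                  ≈⟨ ⊗-distribˡ P (s ⊗ X) (t ⊗ Y) ⟩
    (P ⊗ (s ⊗ X)) ⊕ (P ⊗ (t ⊗ Y))            ≈⟨ ⊕-cong (⊗-congˡ (s ⊗ X) P≋YB) (⊗-congˡ (t ⊗ Y) P≋XA) ⟩
    ((Y ⊗ B) ⊗ (s ⊗ X)) ⊕ ((X ⊗ A) ⊗ (t ⊗ Y)) ≈⟨ regroup X Y A B s t ⟩
    (X ⊗ Y) ⊗ ((s ⊗ B) ⊕ (t ⊗ A))            ∎
    where
    open ≋-Reasoning
    regroup : ∀ X Y A B s t → ((Y ⊗ B) ⊗ (s ⊗ X)) ⊕ ((X ⊗ A) ⊗ (t ⊗ Y)) ≋ (X ⊗ Y) ⊗ ((s ⊗ B) ⊕ (t ⊗ A))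
    regroup = solve-∀ polyACR

-- The product formula ∏_{d ∣ n} Φ_d = xⁿ − 1

cycF-stable : ∀ {f g n} → 1 ≤ n → n ≤ f → n ≤ g → cycF f n ≡ cycF g n
cycF-stable {suc f} {suc g} {suc m} _ (s≤s m≤f) (s≤s m≤g) =
  cong (λ ds → divP (xn-1 (suc m)) (prodP ds) (suc m))
       (List.map-cong-local
         (All.map (λ (1≤d , d≤m) → cycF-stable 1≤d (ℕ.≤-trans d≤m m≤f) (ℕ.≤-trans d≤m m≤g))
                  (All.filter⁺ (T? ∘ (_∣ᵇ suc m)) (range-bounds m))))

Φ-rec : ∀ m → Φ (suc m) ≡ divP (xn-1 (suc m)) (prodP (map Φ (properDivisors (suc m)))) (suc m)
Φ-rec m = cong (λ ds → divP (xn-1 (suc m)) (prodP ds) (suc m))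
               (List.map-cong-local (All.map (λ (1≤d , d≤m) → cycF-stable 1≤d d≤m ℕ.≤-refl)
                                             (All.filter⁺ (T? ∘ (_∣ᵇ suc m)) (range-bounds m))))

-- Parametrised by the defining recursion of Φ only, so that cycF is never unfolded.
module Factorisation
  (F : ℕ → Poly)
  (F-rec : ∀ m → F (suc m) ≡ divP (xn-1 (suc m)) (prodP (map F (properDivisors (suc m)))) (suc m))
  where

  Factorises : ℕ → Set
  Factorises n = ∏≤ F n (_∣ᵇ n) ≋ xn-1 n × IsUnit (coeff (F n) 0)

  properProduct : ℕ → Poly
  properProduct n = ∏≤ F (n ∸ 1) (_∣ᵇ n)

  ∏-divisors≋proper⊗F : ∀ m → ∏≤ F (suc m) (_∣ᵇ suc m) ≋ properProduct (suc m) ⊗ F (suc m)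
  ∏-divisors≋proper⊗F m =
    ⊗-congʳ (properProduct (suc m)) (≡⇒≋ (factorIf-true F (_∣ᵇ suc m) (∣ᵇ-true ∣-refl)))

  module Step (n : ℕ) (IH : ∀ {d} → 1 ≤ d → d < n → Factorises d) where

    xn-1≋proper⊗F : ∀ {d} → 1 ≤ d → d < n → xn-1 d ≋ properProduct d ⊗ F d
    xn-1≋proper⊗F {suc m} 1≤d d<n = ≋-trans (≋-sym (proj₁ (IH 1≤d d<n))) (∏-divisors≋proper⊗F m)

    F∣xn-1 : ∀ {b N} → 1 ≤ b → b < n → b ∣ N → ∃ λ B → xn-1 N ≋ F b ⊗ B
    F∣xn-1 {b} {N} 1≤b b<n (divides k N≡kb) = properProduct b ⊗ geometric b k , (begin
      xn-1 N                                          ≡⟨ cong xn-1 (trans N≡kb (ℕ.*-comm k b)) ⟩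
      xn-1 (b ℕ.* k)                                  ≈⟨ geometric-sum b k ⟨
      xn-1 b ⊗ geometric b k                          ≈⟨ ⊗-congˡ (geometric b k) (xn-1≋proper⊗F 1≤b b<n) ⟩
      (properProduct b ⊗ F b) ⊗ geometric b k         ≈⟨ rotate (properProduct b) (F b) (geometric b k) ⟩
      F b ⊗ (properProduct b ⊗ geometric b k)         ∎)
      where
      open ≋-Reasoning
      rotate : ∀ Q F G → (Q ⊗ F) ⊗ G ≋ F ⊗ (Q ⊗ G)
      rotate = solve-∀ polyACR

    nonDivisorsOf : ℕ → ℕ → Poly
    nonDivisorsOf g b = ∏≤ F (b ∸ 1) (λ d → d ∣ᵇ b ∧ not (d ∣ᵇ g))

    properProduct-split : ∀ {g b} → 1 ≤ g → g ∣ b → g < b → b < n →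
                          properProduct b ≋ xn-1 g ⊗ nonDivisorsOf g b
    properProduct-split {g} {suc m} 1≤g g∣b g<b b<n = begin
      ∏≤ F m (_∣ᵇ suc m)                                           ≈⟨ ∏≤-split F m (_∣ᵇ suc m) (_∣ᵇ g) ⟩
      ∏≤ F m (λ d → d ∣ᵇ suc m ∧ d ∣ᵇ g) ⊗ nonDivisorsOf g (suc m)  ≈⟨ ⊗-congˡ _ common≋xn-1 ⟩
      xn-1 g ⊗ nonDivisorsOf g (suc m)                              ∎
      where
      open ≋-Reasoning
      ∣g⇒∣b : ∀ d → 1 ≤ d → d ≤ m → (d ∣ᵇ suc m ∧ d ∣ᵇ g) ≡ (d ∣ᵇ g)
      ∣g⇒∣b d _ _ with d ∣? g
      ... | yes d∣g = cong (_∧ true) (∣ᵇ-true (∣-trans d∣g g∣b))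
      ... | no  _   = Bool.∧-zeroʳ (d ∣ᵇ suc m)
      beyond-g : ∀ d → g < d → d ≤ m → (d ∣ᵇ g) ≡ false
      beyond-g d g<d _ = ∣ᵇ-false (λ d∣g → ℕ.<⇒≱ g<d (∣⇒≤ {{ℕ.>-nonZero 1≤g}} d∣g))
      common≋xn-1 : ∏≤ F m (λ d → d ∣ᵇ suc m ∧ d ∣ᵇ g) ≋ xn-1 g
      common≋xn-1 = begin
        ∏≤ F m (λ d → d ∣ᵇ suc m ∧ d ∣ᵇ g)
          ≈⟨ ∏≤-cong m ∣g⇒∣b (λ _ _ _ _ → ≋-refl) ⟩
        ∏≤ F m (_∣ᵇ g)
          ≈⟨ ∏≤-trim F (_∣ᵇ g) (ℕ.≤-pred g<b) beyond-g ⟩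
        ∏≤ F g (_∣ᵇ g)
          ≈⟨ proj₁ (IH 1≤g (ℕ.<-trans g<b b<n)) ⟩
        xn-1 g ∎

    geometric≋nonDivisors⊗F : ∀ {g b k} → 1 ≤ g → b ≡ k ℕ.* g → g < b → b < n →
                              geometric g k ≋ nonDivisorsOf g b ⊗ F b
    geometric≋nonDivisors⊗F {suc g′} {b} {k} 1≤g b≡kg g<b b<n = ⊗-cancelˡ (xn-1 g) refl (begin
      xn-1 g ⊗ geometric g k
        ≈⟨ geometric-sum g k ⟩
      xn-1 (g ℕ.* k)
        ≡⟨ cong xn-1 (trans (ℕ.*-comm g k) (sym b≡kg)) ⟩
      xn-1 b
        ≈⟨ xn-1≋proper⊗F 1≤b b<n ⟩
      properProduct b ⊗ F b
        ≈⟨ ⊗-congˡ (F b) (properProduct-split 1≤g (divides k b≡kg) g<b b<n) ⟩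
      (xn-1 g ⊗ nonDivisorsOf g b) ⊗ F b
        ≈⟨ ⊗-assoc (xn-1 g) (nonDivisorsOf g b) (F b) ⟩
      xn-1 g ⊗ (nonDivisorsOf g b ⊗ F b) ∎)
      where
      open ≋-Reasoning
      g = suc g′
      1≤b = ℕ.≤-trans 1≤g (ℕ.<⇒≤ g<b)

    -- Take x^g − 1 ∈ (xᵃ − 1, xᵇ − 1) with b = K·g, g < b. Then xᵇ − 1 = (x^g − 1)·geometric g K
    -- = (x^g − 1)·R·F b, so geometric g K = R·F b, while geometric g K ≡ K modulo x^g − 1.
    F-coprime-xn-1 : ∀ {b a} → 1 ≤ b → b < n → ¬ b ∣ a → Coprimeℚ (F b) (xn-1 a)
    F-coprime-xn-1 {b} {a} 1≤b b<n b∤a with xn-1-bezout a b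
    ... | zero , _ , divides k b≡k*0 , _ = contradiction (trans b≡k*0 (ℕ.*-zeroʳ k)) (ℕ.>⇒≢ 1≤b)
    ... | suc g′ , _ , divides zero b≡0 , _ = contradiction b≡0 (ℕ.>⇒≢ 1≤b)
    ... | suc g′ , g∣a , divides (suc k′) b≡Kg , U , V , bezout with geometric-mod (suc g′) (suc k′)
    ...   | W , G≋K+XW = k′ , R ⊕ neg ((V ⊗ properProduct b) ⊗ W) , neg (U ⊗ W) , (begin
      constP K
        ≈⟨ subtract (constP K) (xn-1 g ⊗ W) ⟩
      (constP K ⊕ (xn-1 g ⊗ W)) ⊕ neg (xn-1 g ⊗ W)
        ≈⟨ ⊕-cong (≋-trans (≋-sym G≋K+XW) (geometric≋nonDivisors⊗F {k = K} (s≤s z≤n) b≡Kg g<b b<n))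
          (scale-cong (- + 1) (⊗-congˡ W xn-1g≋)) ⟩
      (R ⊗ F b) ⊕ neg (((U ⊗ xn-1 a) ⊕ (V ⊗ (properProduct b ⊗ F b))) ⊗ W)
        ≈⟨ regroup R (F b) U V (xn-1 a) (properProduct b) W ⟩
      ((R ⊕ neg ((V ⊗ properProduct b) ⊗ W)) ⊗ F b) ⊕ (neg (U ⊗ W) ⊗ xn-1 a) ∎)
      where
      open ≋-Reasoning
      g = suc g′
      K = suc k′
      R = nonDivisorsOf g b
      g<b : g < b
      g<b = ℕ.≤∧≢⇒< (∣⇒≤ {{ℕ.>-nonZero 1≤b}} (divides K b≡Kg)) (λ g≡b → b∤a (subst (_∣ a) g≡b g∣a))
      xn-1g≋ : xn-1 g ≋ (U ⊗ xn-1 a) ⊕ (V ⊗ (properProduct b ⊗ F b))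
      xn-1g≋ = ≋-trans bezout (⊕-congʳ (U ⊗ xn-1 a) (⊗-congʳ V (xn-1≋proper⊗F 1≤b b<n)))
      subtract : ∀ K Y → K ≋ (K ⊕ Y) ⊕ neg Y
      subtract = solve-∀ polyACR
      regroup : ∀ R F U V A Q W → (R ⊗ F) ⊕ neg (((U ⊗ A) ⊕ (V ⊗ (Q ⊗ F))) ⊗ W) ≋
                                  ((R ⊕ neg ((V ⊗ Q) ⊗ W)) ⊗ F) ⊕ (neg (U ⊗ W) ⊗ A)
      regroup = solve-∀ polyACR

    F-coprime : ∀ {d b} → 1 ≤ d → d < n → 1 ≤ b → b < n → d ≢ b → Coprimeℚ (F d) (F b)
    F-coprime {d} {b} 1≤d d<n 1≤b b<n d≢b with b ∣? d
    ... | no  b∤d = Coprimeℚ-sym (Coprimeℚ-divisorʳ (properProduct d)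
                                    (F-coprime-xn-1 1≤b b<n b∤d) (xn-1≋proper⊗F 1≤d d<n))
    ... | yes b∣d = Coprimeℚ-divisorʳ (properProduct b)
                      (F-coprime-xn-1 1≤d d<n (λ d∣b → d≢b (∣-antisym d∣b b∣d))) (xn-1≋proper⊗F 1≤b b<n)

    ∏-coprime : ∀ {M b} P → M < b → b < n → Coprimeℚ (∏≤ F M P) (F b)
    ∏-coprime {zero}  {b} P M<b b<n = Coprimeℚ-oneˡ (F b)
    ∏-coprime {suc M} {b} P M<b b<n =
      Coprimeℚ-⊗ˡ (∏-coprime P (ℕ.<-trans (ℕ.n<1+n M) M<b) b<n) last
      where
      last : Coprimeℚ (factorIf F P (suc M)) (F b)
      last with P (suc M)
      ... | true  = F-coprime (s≤s z≤n) (ℕ.<-trans M<b b<n) (ℕ.≤-trans (s≤s z≤n) M<b) b<n (ℕ.<⇒≢ M<b)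
      ... | false = Coprimeℚ-oneˡ (F b)

    IsUnit-F₀ : ∀ {d} → 1 ≤ d → d < n → IsUnit (coeff (F d) 0)
    IsUnit-F₀ 1≤d d<n = proj₂ (IH 1≤d d<n)

    IsUnit-∏₀ : ∀ M P → M < n → IsUnit (coeff (∏≤ F M P) 0)
    IsUnit-∏₀ M P M<n = IsUnit-coeff₀-∏≤ F M P (λ d 1≤d d≤M → IsUnit-F₀ 1≤d (ℕ.≤-<-trans d≤M M<n))

    xn-1-divisible : ∀ M → M < n → ∃ λ A → xn-1 n ≋ ∏≤ F M (_∣ᵇ n) ⊗ A
    xn-1-divisible zero    _   = xn-1 n , ≋-sym (⊗-identityˡ (xn-1 n))
    xn-1-divisible (suc M) M<n with xn-1-divisible M (ℕ.<⇒≤ M<n) | suc M ∣? n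
    ... | A , xn-1≋QA | no _      = A , ≋-trans xn-1≋QA (⊗-congˡ A (≋-sym (⊗-identityʳ (∏≤ F M (_∣ᵇ n)))))
    ... | A , xn-1≋QA | yes M+1∣n =
      Coprimeℚ-lcm (∏-coprime (_∣ᵇ n) ℕ.≤-refl M<n) (IsUnit-∏₀ M (_∣ᵇ n) (ℕ.<⇒≤ M<n)) (IsUnit-F₀ (s≤s z≤n) M<n)
                   xn-1≋QA (proj₂ (F∣xn-1 (s≤s z≤n) M<n M+1∣n))

    -- Q ⊗ A = xⁿ − 1 with Q(0) = ±1 forces deg A ≤ n, so the truncated quotient F n is A.
    factorises : 1 ≤ n → Factorises n
    factorises (s≤s {n = m} z≤n) = ∏-divisors≋xn-1 , IsUnit-F₀-n
      where
      Q = properProduct n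
      A = proj₁ (xn-1-divisible m ℕ.≤-refl)
      xn-1≋QA : xn-1 n ≋ Q ⊗ A
      xn-1≋QA = proj₂ (xn-1-divisible m ℕ.≤-refl)
      IsUnit-Q₀ : IsUnit (coeff Q 0)
      IsUnit-Q₀ = IsUnit-∏₀ m (_∣ᵇ n) ℕ.≤-refl
      L = prodP (map F (properDivisors n))
      L≋Q : L ≋ Q
      L≋Q = prodP-filter-range F m (_∣ᵇ n)
      A-degree : Degree≤ n A
      A-degree = Degree≤-cancelˡ Q A (IsUnit⇒≢0 IsUnit-Q₀)
                   (λ k n<k → trans (sym (at xn-1≋QA k)) (xn-1-degree n k n<k))
      F≋A : F n ≋ A
      F≋A = ≋-trans (≡⇒≋ (F-rec m))
              (divP-exact L n (subst IsUnit (sym (at L≋Q 0)) IsUnit-Q₀)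
                          (≋-trans (⊗-congˡ A L≋Q) (≋-sym xn-1≋QA)) A-degree)
      ∏-divisors≋xn-1 : ∏≤ F n (_∣ᵇ n) ≋ xn-1 n
      ∏-divisors≋xn-1 = ≋-trans (∏-divisors≋proper⊗F m) (≋-trans (⊗-congʳ Q F≋A) (≋-sym xn-1≋QA))
      IsUnit-F₀-n : IsUnit (coeff (F n) 0)
      IsUnit-F₀-n = subst IsUnit (sym (at F≋A 0))
                      (IsUnit-*-cancelˡ {coeff Q 0} {coeff A 0} IsUnit-Q₀
                                        (trans (sym (coeff₀-⊗ Q A)) (sym (at xn-1≋QA 0))))

  factorisation : ∀ {n} → 1 ≤ n → Factorises n
  factorisation {n} =
    <-rec (λ n → 1 ≤ n → Factorises n) (λ n rec → Step.factorises n (λ 1≤d d<n → rec d<n 1≤d)) n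

-- Substituting xᵖ

padding : ℕ → Poly → Poly
padding j q = replicate j (+ 0) ++ q

padding≋xpow⊗ : ∀ j q → padding j q ≋ xpow j ⊗ q
padding≋xpow⊗ zero    q = ≋-sym (⊗-identityˡ q)
padding≋xpow⊗ (suc j) q = ≋-trans (shift-cong (padding≋xpow⊗ j q)) (≋-sym (shift-⊗ˡ (xpow j) q))

height-padding : ∀ j q → height (padding j q) ≡ height q
height-padding zero    q = refl
height-padding (suc j) q = height-padding j q

module Dilation (p′ : ℕ) where

  p : ℕ
  p = suc p′

  -- dilate q = q(xᵖ)
  dilate : Poly → Poly
  dilate []      = []
  dilate (a ∷ q) = a ∷ padding p′ (dilate q)

  dilate-∷ : ∀ a q → dilate (a ∷ q) ≋ (a ∷ []) ⊕ (xpow p ⊗ dilate q)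
  dilate-∷ a q = ≋-trans (∷-split a (padding p′ (dilate q))) (⊕-congʳ (a ∷ []) (padding≋xpow⊗ p (dilate q)))

  height-dilate : ∀ q → height (dilate q) ≡ height q
  height-dilate []      = refl
  height-dilate (a ∷ q) = cong (ℤ.∣ a ∣ ⊔_) (trans (height-padding p′ (dilate q)) (height-dilate q))

  coeff₀-dilate : ∀ q → coeff (dilate q) 0 ≡ coeff q 0
  coeff₀-dilate []      = refl
  coeff₀-dilate (a ∷ q) = refl

  dilate-≋[] : ∀ {q} → q ≋ [] → dilate q ≋ []
  dilate-≋[] {[]}    _ = ≋-refl
  dilate-≋[] {a ∷ q} e = begin
    dilate (a ∷ q)
      ≈⟨ dilate-∷ a q ⟩
    (a ∷ []) ⊕ (xpow p ⊗ dilate q)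
      ≈⟨ ⊕-cong (∷-cong (at e 0) ≋-refl) (⊗-congʳ (xpow p) (dilate-≋[] {q} (mk≋ λ k → at e (suc k)))) ⟩
    (+ 0 ∷ []) ⊕ (xpow p ⊗ [])
      ≈⟨ ⊕-congʳ (+ 0 ∷ []) (⊗-zeroʳ (xpow p)) ⟩
    (+ 0 ∷ []) ⊕ []
      ≈⟨ shift-zero ≋-refl ⟩
    [] ∎
    where open ≋-Reasoning

  dilate-cong : ∀ {q r} → q ≋ r → dilate q ≋ dilate r
  dilate-cong {[]}    {r}     e = ≋-sym (dilate-≋[] (≋-sym e))
  dilate-cong {a ∷ q} {[]}    e = dilate-≋[] e
  dilate-cong {a ∷ q} {b ∷ r} e = ∷-cong (at e 0) (padding-cong (dilate-cong (mk≋ λ k → at e (suc k))))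
    where
    padding-cong : ∀ {A B} → A ≋ B → padding p′ A ≋ padding p′ B
    padding-cong {A} {B} A≋B =
      ≋-trans (padding≋xpow⊗ p′ A) (≋-trans (⊗-congʳ (xpow p′) A≋B) (≋-sym (padding≋xpow⊗ p′ B)))

  dilate-⊕ : ∀ q r → dilate (q ⊕ r) ≋ dilate q ⊕ dilate r
  dilate-⊕ []      r       = ≋-refl
  dilate-⊕ (a ∷ q) []      = ≋-sym (⊕-identityʳ (dilate (a ∷ q)))
  dilate-⊕ (a ∷ q) (b ∷ r) = begin
    dilate ((a ℤ.+ b) ∷ (q ⊕ r))
      ≈⟨ dilate-∷ (a ℤ.+ b) (q ⊕ r) ⟩
    ((a ℤ.+ b) ∷ []) ⊕ (xpow p ⊗ dilate (q ⊕ r))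
      ≈⟨ ⊕-congʳ ((a ℤ.+ b) ∷ []) (⊗-congʳ (xpow p) (dilate-⊕ q r)) ⟩
    ((a ∷ []) ⊕ (b ∷ [])) ⊕ (xpow p ⊗ (dilate q ⊕ dilate r))
      ≈⟨ regroup (a ∷ []) (b ∷ []) (dilate q) (dilate r) (xpow p) ⟩
    ((a ∷ []) ⊕ (xpow p ⊗ dilate q)) ⊕ ((b ∷ []) ⊕ (xpow p ⊗ dilate r))
      ≈⟨ ⊕-cong (dilate-∷ a q) (dilate-∷ b r) ⟨
    dilate (a ∷ q) ⊕ dilate (b ∷ r) ∎
    where
    open ≋-Reasoning
    regroup : ∀ A B Q R X → (A ⊕ B) ⊕ (X ⊗ (Q ⊕ R)) ≋ (A ⊕ (X ⊗ Q)) ⊕ (B ⊕ (X ⊗ R))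
    regroup = solve-∀ polyACR

  dilate-scale : ∀ c q → dilate (scale c q) ≋ scale c (dilate q)
  dilate-scale c []      = ≋-refl
  dilate-scale c (a ∷ q) = begin
    dilate ((c ℤ.* a) ∷ scale c q)
      ≈⟨ dilate-∷ (c ℤ.* a) (scale c q) ⟩
    ((c ℤ.* a) ∷ []) ⊕ (xpow p ⊗ dilate (scale c q))
      ≈⟨ ⊕-congʳ ((c ℤ.* a) ∷ []) (⊗-congʳ (xpow p) (dilate-scale c q)) ⟩
    ((c ℤ.* a) ∷ []) ⊕ (xpow p ⊗ scale c (dilate q))
      ≈⟨ ⊕-congʳ ((c ℤ.* a) ∷ []) (⊗-scaleʳ c (xpow p) (dilate q)) ⟩
    scale c (a ∷ []) ⊕ scale c (xpow p ⊗ dilate q)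
      ≈⟨ scale-⊕ c (a ∷ []) (xpow p ⊗ dilate q) ⟨
    scale c ((a ∷ []) ⊕ (xpow p ⊗ dilate q))
      ≈⟨ scale-cong c (dilate-∷ a q) ⟨
    scale c (dilate (a ∷ q)) ∎
    where open ≋-Reasoning

  dilate-shift : ∀ q → dilate (shift q) ≋ xpow p ⊗ dilate q
  dilate-shift q = padding≋xpow⊗ p (dilate q)

  dilate-⊗ : ∀ q r → dilate (q ⊗ r) ≋ dilate q ⊗ dilate r
  dilate-⊗ []      r = ≋-refl
  dilate-⊗ (a ∷ q) r = begin
    dilate (scale a r ⊕ shift (q ⊗ r))
      ≈⟨ dilate-⊕ (scale a r) (shift (q ⊗ r)) ⟩
    dilate (scale a r) ⊕ dilate (shift (q ⊗ r))
      ≈⟨ ⊕-cong (dilate-scale a r) (dilate-shift (q ⊗ r)) ⟩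
    scale a (dilate r) ⊕ (xpow p ⊗ dilate (q ⊗ r))
      ≈⟨ ⊕-cong (≋-sym (⊗-constʳ (dilate r) a)) (⊗-congʳ (xpow p) (dilate-⊗ q r)) ⟩
    (dilate r ⊗ (a ∷ [])) ⊕ (xpow p ⊗ (dilate q ⊗ dilate r))
      ≈⟨ regroup (a ∷ []) (dilate q) (dilate r) (xpow p) ⟩
    ((a ∷ []) ⊕ (xpow p ⊗ dilate q)) ⊗ dilate r
      ≈⟨ ⊗-congˡ (dilate r) (dilate-∷ a q) ⟨
    dilate (a ∷ q) ⊗ dilate r ∎
    where
    open ≋-Reasoning
    regroup : ∀ A Q R X → (R ⊗ A) ⊕ (X ⊗ (Q ⊗ R)) ≋ (A ⊕ (X ⊗ Q)) ⊗ R
    regroup = solve-∀ polyACR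

  dilate-one : dilate one ≋ one
  dilate-one = ∷-cong refl (padding≋[] p′)
    where
    padding≋[] : ∀ j → padding j [] ≋ []
    padding≋[] zero    = ≋-refl
    padding≋[] (suc j) = shift-zero (padding≋[] j)

  dilate-xpow : ∀ m → dilate (xpow m) ≋ xpow (p ℕ.* m)
  dilate-xpow zero    = ≋-trans dilate-one (≡⇒≋ (cong xpow (sym (ℕ.*-zeroʳ p))))
  dilate-xpow (suc m) = begin
    dilate (shift (xpow m))          ≈⟨ dilate-shift (xpow m) ⟩
    xpow p ⊗ dilate (xpow m)         ≈⟨ ⊗-congʳ (xpow p) (dilate-xpow m) ⟩
    xpow p ⊗ xpow (p ℕ.* m)          ≈⟨ xpow-+ p (p ℕ.* m) ⟨
    xpow (p ℕ.+ p ℕ.* m)             ≡⟨ cong xpow (ℕ.*-suc p m) ⟨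
    xpow (p ℕ.* suc m)               ∎
    where open ≋-Reasoning

  dilate-xn-1 : ∀ m → dilate (xn-1 m) ≋ xn-1 (p ℕ.* m)
  dilate-xn-1 m = begin
    dilate (xn-1 m)
      ≈⟨ dilate-cong (xn-1≋ m) ⟩
    dilate (xpow m ⊕ neg one)
      ≈⟨ dilate-⊕ (xpow m) (neg one) ⟩
    dilate (xpow m) ⊕ dilate (neg one)
      ≈⟨ ⊕-cong (dilate-xpow m) (≋-trans (dilate-scale (- + 1) one) (scale-cong (- + 1) dilate-one)) ⟩
    xpow (p ℕ.* m) ⊕ neg one
      ≈⟨ xn-1≋ (p ℕ.* m) ⟨
    xn-1 (p ℕ.* m) ∎
    where open ≋-Reasoning

  dilate-∏≤ : ∀ F N P → dilate (∏≤ F N P) ≋ ∏≤ (dilate ∘ F) N P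
  dilate-∏≤ F zero    P = dilate-one
  dilate-∏≤ F (suc N) P = ≋-trans (dilate-⊗ (∏≤ F N P) (factorIf F P (suc N))) (⊗-cong (dilate-∏≤ F N P) last)
    where
    last : dilate (factorIf F P (suc N)) ≋ factorIf (dilate ∘ F) P (suc N)
    last with P (suc N)
    ... | true  = ≋-refl
    ... | false = dilate-one

∏≤-multiples : ∀ p′ F N (P′ P : ℕ → Bool) → (∀ e → 1 ≤ e → e ≤ N → P′ (suc p′ ℕ.* e) ≡ P e) →
               ∏≤ F (suc p′ ℕ.* N) (λ f → P′ f ∧ suc p′ ∣ᵇ f) ≋ ∏≤ (F ∘ (suc p′ ℕ.*_)) N P
∏≤-multiples p′ F zero    P′ P _     =
  ≡⇒≋ (cong (λ M → ∏≤ F M (λ f → P′ f ∧ suc p′ ∣ᵇ f)) (ℕ.*-zeroʳ (suc p′)))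
∏≤-multiples p′ F (suc N) P′ P P′≗P = begin
  ∏≤ F (p ℕ.* suc N) Q
    ≡⟨ cong (λ M → ∏≤ F M Q) p[N+1]≡ ⟩
  ∏≤ F (p ℕ.* N ℕ.+ p′) Q ⊗ factorIf F Q (suc (p ℕ.* N ℕ.+ p′))
    ≈⟨ ⊗-cong (∏≤-trim F Q (ℕ.m≤m+n (p ℕ.* N) p′) gap) (≡⇒≋ (cong (factorIf F Q) (sym p[N+1]≡))) ⟩
  ∏≤ F (p ℕ.* N) Q ⊗ factorIf F Q (p ℕ.* suc N)
    ≈⟨ ⊗-cong (∏≤-multiples p′ F N P′ P (λ e 1≤e e≤N → P′≗P e 1≤e (ℕ.m≤n⇒m≤1+n e≤N))) (≡⇒≋ last) ⟩
  ∏≤ (F ∘ (p ℕ.*_)) N P ⊗ factorIf (F ∘ (p ℕ.*_)) P (suc N) ∎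
  where
  open ≋-Reasoning
  p = suc p′
  Q : ℕ → Bool
  Q f = P′ f ∧ p ∣ᵇ f
  p[N+1]≡ : p ℕ.* suc N ≡ suc (p ℕ.* N ℕ.+ p′)
  p[N+1]≡ = trans (ℕ.*-suc p N) (cong suc (ℕ.+-comm p′ (p ℕ.* N)))
  gap : ∀ f → p ℕ.* N < f → f ≤ p ℕ.* N ℕ.+ p′ → Q f ≡ false
  gap f pN<f f≤pN+p′ = trans (cong (P′ f ∧_) (∣ᵇ-false p∤f)) (Bool.∧-zeroʳ (P′ f))
    where
    j = f ∸ p ℕ.* N
    f≡pN+j : f ≡ p ℕ.* N ℕ.+ j
    f≡pN+j = sym (ℕ.m+[n∸m]≡n (ℕ.<⇒≤ pN<f))
    p∤f : ¬ p ∣ f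
    p∤f p∣f = ℕ.<⇒≱ (s≤s (ℕ.+-cancelˡ-≤ (p ℕ.* N) j p′ (subst (_≤ p ℕ.* N ℕ.+ p′) f≡pN+j f≤pN+p′)))
                    (∣⇒≤ {{ℕ.>-nonZero (ℕ.m<n⇒0<n∸m pN<f)}} (∣m+n∣m⇒∣n (subst (p ∣_) f≡pN+j p∣f) (m∣m*n N)))
  last : factorIf F Q (p ℕ.* suc N) ≡ factorIf (F ∘ (p ℕ.*_)) P (suc N)
  last rewrite ∣ᵇ-true {p} {p ℕ.* suc N} (m∣m*n (suc N))
             | Bool.∧-identityʳ (P′ (p ℕ.* suc N))
             | P′≗P (suc N) (s≤s z≤n) ℕ.≤-refl = refl

open Factorisation Φ Φ-rec

module _ {p′ : ℕ} (prime : Prime (suc p′)) where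

  open Dilation p′

  cofactor : ℕ → Poly
  cofactor = factorIf Φ (λ e → not (p ∣ᵇ e))

  dilatedFactor : ℕ → Poly
  dilatedFactor e = Φ (p ℕ.* e) ⊗ cofactor e

  coprime-of-∤ : ∀ {f} → ¬ p ∣ f → Coprime f p
  coprime-of-∤ p∤f (c∣f , c∣p) with prime⇒irreducible prime c∣p
  ... | inj₁ c≡1 = c≡1
  ... | inj₂ refl = contradiction c∣f p∤f

  -- The divisors of pd are the p·e with e ∣ d, together with the divisors of d prime to p.
  xn-1-pd : ∀ {d} → 1 ≤ d → xn-1 (p ℕ.* d) ≋ ∏≤ dilatedFactor d (_∣ᵇ d)
  xn-1-pd {d} 1≤d = begin
    xn-1 (p ℕ.* d)
      ≈⟨ proj₁ (factorisation 1≤pd) ⟨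
    ∏≤ Φ (p ℕ.* d) (_∣ᵇ p ℕ.* d)
      ≈⟨ ∏≤-split Φ (p ℕ.* d) (_∣ᵇ p ℕ.* d) (p ∣ᵇ_) ⟩
    ∏≤ Φ (p ℕ.* d) (λ f → f ∣ᵇ p ℕ.* d ∧ p ∣ᵇ f) ⊗ ∏≤ Φ (p ℕ.* d) coprimeToP
      ≈⟨ ⊗-cong (∏≤-multiples p′ Φ d (_∣ᵇ p ℕ.* d) (_∣ᵇ d) (λ e _ _ → ∣ᵇ-pe∣pd e))
        (∏≤-cong (p ℕ.* d) coprime-part (λ _ _ _ _ → ≋-refl)) ⟩
    ∏≤ (Φ ∘ (p ℕ.*_)) d (_∣ᵇ d) ⊗ ∏≤ Φ (p ℕ.* d) (λ f → f ∣ᵇ d ∧ not (p ∣ᵇ f))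
      ≈⟨ ⊗-congʳ (∏≤ (Φ ∘ (p ℕ.*_)) d (_∣ᵇ d)) (∏≤-trim Φ _ (ℕ.m≤n*m d p) beyond-d) ⟩
    ∏≤ (Φ ∘ (p ℕ.*_)) d (_∣ᵇ d) ⊗ ∏≤ Φ d (λ f → f ∣ᵇ d ∧ not (p ∣ᵇ f))
      ≈⟨ ⊗-congʳ (∏≤ (Φ ∘ (p ℕ.*_)) d (_∣ᵇ d)) (∏≤-∧ Φ d (_∣ᵇ d) (λ f → not (p ∣ᵇ f))) ⟩
    ∏≤ (Φ ∘ (p ℕ.*_)) d (_∣ᵇ d) ⊗ ∏≤ cofactor d (_∣ᵇ d)
      ≈⟨ ∏≤-⊗ (Φ ∘ (p ℕ.*_)) cofactor d (_∣ᵇ d) ⟨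
    ∏≤ dilatedFactor d (_∣ᵇ d) ∎
    where
    open ≋-Reasoning
    1≤pd = ℕ.*-mono-≤ {1} {p} {1} {d} (s≤s z≤n) 1≤d
    coprimeToP : ℕ → Bool
    coprimeToP f = f ∣ᵇ p ℕ.* d ∧ not (p ∣ᵇ f)
    ∣ᵇ-pe∣pd : ∀ e → (p ℕ.* e ∣ᵇ p ℕ.* d) ≡ (e ∣ᵇ d)
    ∣ᵇ-pe∣pd e = ∣ᵇ-cong (mk⇔ (*-cancelˡ-∣ p) (*-monoʳ-∣ p))
    coprime-part : ∀ f → 1 ≤ f → f ≤ p ℕ.* d → coprimeToP f ≡ (f ∣ᵇ d ∧ not (p ∣ᵇ f))
    coprime-part f _ _ with p ∣? f
    ... | yes _   = trans (Bool.∧-zeroʳ _) (sym (Bool.∧-zeroʳ _))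
    ... | no  p∤f =
      cong (_∧ true) (∣ᵇ-cong (mk⇔ (coprime-divisor (coprime-of-∤ p∤f)) (λ f∣d → ∣-trans f∣d (n∣m*n p))))
    beyond-d : ∀ f → d < f → f ≤ p ℕ.* d → (f ∣ᵇ d ∧ not (p ∣ᵇ f)) ≡ false
    beyond-d f d<f _ = cong (_∧ not (p ∣ᵇ f)) (∣ᵇ-false (λ f∣d → ℕ.<⇒≱ d<f (∣⇒≤ {{ℕ.>-nonZero 1≤d}} f∣d)))

  dilate-Φ : ∀ {d} → 1 ≤ d → dilate (Φ d) ≋ dilatedFactor d
  dilate-Φ {n} = <-rec (λ d → 1 ≤ d → dilate (Φ d) ≋ dilatedFactor d) step n
    where
    step : ∀ d → (∀ {e} → e < d → 1 ≤ e → dilate (Φ e) ≋ dilatedFactor e) →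
           1 ≤ d → dilate (Φ d) ≋ dilatedFactor d
    step (suc m) IH 1≤d = ⊗-cancelˡ (dilate Q) unit (begin
      dilate Q ⊗ dilate (Φ d)
        ≈⟨ dilate-⊗ Q (Φ d) ⟨
      dilate (Q ⊗ Φ d)
        ≈⟨ dilate-cong (≋-trans (≋-sym (proj₁ (factorisation 1≤d))) (∏-divisors≋proper⊗F m)) ⟨
      dilate (xn-1 d)
        ≈⟨ dilate-xn-1 d ⟩
      xn-1 (p ℕ.* d)
        ≈⟨ xn-1-pd 1≤d ⟩
      ∏≤ dilatedFactor m (_∣ᵇ d) ⊗ factorIf dilatedFactor (_∣ᵇ d) d
        ≈⟨ ⊗-cong (∏≤-cong m (λ _ _ _ → refl) (λ e 1≤e e≤m _ → ≋-sym (IH (s≤s e≤m) 1≤e)))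
          (≡⇒≋ (factorIf-true dilatedFactor (_∣ᵇ d) {d} (∣ᵇ-true ∣-refl))) ⟩
      ∏≤ (dilate ∘ Φ) m (_∣ᵇ d) ⊗ dilatedFactor d
        ≈⟨ ⊗-congˡ (dilatedFactor d) (dilate-∏≤ Φ m (_∣ᵇ d)) ⟨
      dilate Q ⊗ dilatedFactor d ∎)
      where
      open ≋-Reasoning
      d = suc m
      Q = properProduct d
      unit : IsUnit (coeff (dilate Q) 0)
      unit rewrite coeff₀-dilate Q = IsUnit-coeff₀-∏≤ Φ m (_∣ᵇ d) (λ e 1≤e _ → proj₂ (factorisation 1≤e))

  dilate-Φ-multiple : ∀ {d} → 1 ≤ d → p ∣ d → dilate (Φ d) ≋ Φ (p ℕ.* d)
  dilate-Φ-multiple {d} 1≤d p∣d =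
    ≋-trans (dilate-Φ 1≤d) (≋-trans (⊗-congʳ (Φ (p ℕ.* d)) (≡⇒≋ no-cofactor)) (⊗-identityʳ (Φ (p ℕ.* d))))
    where
    no-cofactor : cofactor d ≡ one
    no-cofactor rewrite ∣ᵇ-true p∣d = refl

  height-Φ-multiple : ∀ {d} → 1 ≤ d → p ∣ d → height (Φ (p ℕ.* d)) ≡ height (Φ d)
  height-Φ-multiple {d} 1≤d p∣d = trans (sym (height-cong (dilate-Φ-multiple 1≤d p∣d))) (height-dilate (Φ d))

-- Reduction to squarefree indices

SquareFree : ℕ → Set
SquareFree n = ∀ k → 2 ≤ k → ¬ k ℕ.* k ∣ n

square-factor-or-squarefree : ∀ n → 1 ≤ n → (∃ λ k → 2 ≤ k × k ℕ.* k ∣ n) ⊎ SquareFree n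
square-factor-or-squarefree n 1≤n with ℕ.anyUpTo? (λ k → (2 ≤? k) ×-dec (k ℕ.* k ∣? n)) (suc n)
... | yes (k , _ , 2≤k , k²∣n) = inj₁ (k , 2≤k , k²∣n)
... | no  none = inj₂ λ k 2≤k k²∣n → none (k , s≤s (k≤k² k 2≤k k²∣n) , 2≤k , k²∣n)
  where
  k≤k² : ∀ k → 2 ≤ k → k ℕ.* k ∣ n → k ≤ n
  k≤k² k 2≤k k²∣n =
    ℕ.≤-trans (ℕ.m≤m*n k k {{ℕ.>-nonZero (ℕ.≤-trans (s≤s z≤n) 2≤k)}}) (∣⇒≤ {{ℕ.>-nonZero 1≤n}} k²∣n)

prime-factor : ∀ {k} → 2 ≤ k → ∃ λ p → Prime p × p ∣ k
prime-factor {k} 2≤k with factorise k {{ℕ.>-nonZero (ℕ.≤-trans (s≤s z≤n) 2≤k)}}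
... | record { factors = []     ; isFactorisation = k≡1 } = contradiction k≡1 (ℕ.>⇒≢ 2≤k)
... | record { factors = p ∷ ps ; isFactorisation = k≡ ; factorsPrime = p-prime ∷ _ } =
  p , p-prime , divides (product ps) (trans k≡ (ℕ.*-comm p _))

remove-prime-factor : ∀ {n p} → 1 ≤ n → Prime p → p ℕ.* p ∣ n →
                      ∃ λ m → 1 ≤ m × m < n × height (Φ n) ≡ height (Φ m)
remove-prime-factor {n} {zero}   _   0-prime _ = contradiction refl (ℕ.≢-nonZero⁻¹ 0 {{prime⇒nonZero 0-prime}})
remove-prime-factor {n} {suc p′} 1≤n p-prime (divides q n≡qp²) = m , 1≤m , m<n , (begin
  height (Φ n)             ≡⟨ cong (height ∘ Φ) n≡pm ⟩
  height (Φ (p ℕ.* m))     ≡⟨ height-Φ-multiple p-prime 1≤m (n∣m*n q) ⟩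
  height (Φ m)             ∎)
  where
  open ≡-Reasoning
  p = suc p′
  m = q ℕ.* p
  n≡pm : n ≡ p ℕ.* m
  n≡pm = trans n≡qp² (rearrange q p)
    where
    rearrange : ∀ q p → q ℕ.* (p ℕ.* p) ≡ p ℕ.* (q ℕ.* p)
    rearrange = solveℕ
  1≤m : 1 ≤ m
  1≤m = ℕ.n≢0⇒n>0 λ m≡0 → ℕ.>⇒≢ 1≤n (trans n≡pm (trans (cong (p ℕ.*_) m≡0) (ℕ.*-zeroʳ p)))
  m<n : m < n
  m<n = subst (m <_) (trans (ℕ.*-comm m p) (sym n≡pm))
              (ℕ.m<m*n m p {{ℕ.>-nonZero 1≤m}} (ℕ.nonTrivial⇒n>1 p {{prime⇒nonTrivial p-prime}}))

SquareFreeWithHeightOf : ℕ → Set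
SquareFreeWithHeightOf n = ∃ λ n′ → 1 ≤ n′ × SquareFree n′ × height (Φ n′) ≡ height (Φ n)

squarefree-reduction : ∀ {n} → 1 ≤ n → SquareFreeWithHeightOf n
squarefree-reduction {n} = <-rec (λ n → 1 ≤ n → SquareFreeWithHeightOf n) step n
  where
  step : ∀ n → (∀ {m} → m < n → 1 ≤ m → SquareFreeWithHeightOf m) → 1 ≤ n → SquareFreeWithHeightOf n
  step n IH 1≤n with square-factor-or-squarefree n 1≤n
  ... | inj₂ squarefree = n , 1≤n , squarefree , refl
  ... | inj₁ (k , 2≤k , k²∣n) with prime-factor 2≤k
  ...   | p , p-prime , p∣k with remove-prime-factor 1≤n p-prime (∣-trans (*-pres-∣ p∣k p∣k) k²∣n)
  ...     | m , 1≤m , m<n , height-n≡m with IH m<n 1≤m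
  ...       | n′ , 1≤n′ , squarefree , height-n′≡m =
    n′ , 1≤n′ , squarefree , trans height-n′≡m (sym height-n≡m)

-- Unitary cyclotomic polynomials of squarefree index

foldr-⊔-lub : ∀ {b} c xs → c ≤ b → All (_≤ b) xs → foldr _⊔_ c xs ≤ b
foldr-⊔-lub c []       c≤b []         = c≤b
foldr-⊔-lub c (x ∷ xs) c≤b (x≤b ∷ xs≤b) = ℕ.⊔-lub x≤b (foldr-⊔-lub c xs c≤b xs≤b)

≤-foldr-⊔ : ∀ c {x} xs → x ∈ xs → x ≤ foldr _⊔_ c xs
≤-foldr-⊔ c (y ∷ xs) (here refl) = ℕ.m≤m⊔n y _
≤-foldr-⊔ c (y ∷ xs) (there x∈xs) = ℕ.≤-trans (≤-foldr-⊔ c xs x∈xs) (ℕ.m≤n⊔m y _)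

unitaryDivisorᵇ : ℕ → ℕ → ℕ → Bool
unitaryDivisorᵇ j n d = d ∣ᵇ j ∧ unitaryᵇ d n

ustar-1 : ∀ {n} → 1 ≤ n → ustar 1 n ≡ 1
ustar-1 {n} 1≤n = ℕ.≤-antisym
  (foldr-⊔-lub 0 _ z≤n (All.map ≤1 (All.all-filter (T? ∘ unitaryDivisorᵇ 1 n) (range n))))
  (≤-foldr-⊔ 0 _ (∈.∈-filter⁺ (T? ∘ unitaryDivisorᵇ 1 n) (∈-range ℕ.≤-refl 1≤n) 1-unitary))
  where
  ≤1 : ∀ {d} → T (unitaryDivisorᵇ 1 n d) → d ≤ 1
  ≤1 {d} t = ∣⇒≤ (toWitness {a? = d ∣? 1} (proj₁ (Equivalence.to (Bool.T-∧ {d ∣ᵇ 1}) t)))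
  1-unitary : T (unitaryDivisorᵇ 1 n 1)
  1-unitary rewrite ∣ᵇ-true (1∣ n) | gcd-zeroˡ (n / 1) = _

ustar-squarefree : ∀ {n j d} → SquareFree n → n ≡ j ℕ.* d → 1 ≤ j → 1 ≤ d → j ≤ ustar j n
ustar-squarefree {n} {suc j′} {d} squarefree n≡jd 1≤j 1≤d =
  ≤-foldr-⊔ 0 _ (∈.∈-filter⁺ (T? ∘ unitaryDivisorᵇ j n) (∈-range 1≤j j≤n) j-unitary)
  where
  j = suc j′
  j∣n : j ∣ n
  j∣n = divides d (trans n≡jd (ℕ.*-comm j d))
  j≤n : j ≤ n
  j≤n = ∣⇒≤ {{ℕ.>-nonZero (subst (1 ≤_) (sym n≡jd) (ℕ.*-mono-≤ 1≤j 1≤d))}} j∣n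
  n/j≡d : n / j ≡ d
  n/j≡d = trans (cong (_/ j) (trans n≡jd (ℕ.*-comm j d))) (m*n/n≡m d j)
  gcd≡1 : gcd j d ≡ 1
  gcd≡1 with gcd j d | gcd[m,n]∣m j d | gcd[m,n]∣n j d | gcd[m,n]≢0 j d (inj₁ λ ())
  ... | zero        | _   | _   | g≢0 = contradiction refl g≢0
  ... | suc zero    | _   | _   | _   = refl
  ... | suc (suc g) | g∣j | g∣d | _   =
    contradiction (subst (_ ∣_) (sym n≡jd) (*-pres-∣ g∣j g∣d)) (squarefree (suc (suc g)) (s≤s (s≤s z≤n)))
  j-unitary : T (unitaryDivisorᵇ j n j)
  j-unitary rewrite ∣ᵇ-true {j} {j} ∣-refl | ∣ᵇ-true j∣n | n/j≡d | gcd≡1 = _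

≥2⇒≢ᵇ1 : ∀ {x} → 2 ≤ x → (x ≡ᵇ 1) ≡ false
≥2⇒≢ᵇ1 (s≤s (s≤s _)) = refl

cofactor-≥2 : ∀ {n j d} → n ≡ j ℕ.* d → d < n → 2 ≤ j
cofactor-≥2 {n} {zero}        {d} n≡0  d<n = contradiction n≡0 (ℕ.>⇒≢ (ℕ.≤-trans (s≤s z≤n) d<n))
cofactor-≥2 {n} {suc zero}    {d} n≡d  d<n = contradiction (trans n≡d (ℕ.+-identityʳ d)) (ℕ.>⇒≢ d<n)
cofactor-≥2 {n} {suc (suc j)} {d} _    _   = s≤s (s≤s z≤n)

filterᵇ-filterᵇ : ∀ {A : Set} (P Q : A → Bool) xs →
                  filterᵇ Q (filterᵇ P xs) ≡ filterᵇ (λ x → P x ∧ Q x) xs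
filterᵇ-filterᵇ P Q []       = refl
filterᵇ-filterᵇ P Q (x ∷ xs) with P x
... | false = filterᵇ-filterᵇ P Q xs
... | true with Q x
...   | true  = cong (x ∷_) (filterᵇ-filterᵇ P Q xs)
...   | false = filterᵇ-filterᵇ P Q xs

Φ*-squarefree : ∀ {n} → 1 ≤ n → SquareFree n → Φ* n ≋ Φ n
Φ*-squarefree {suc m} 1≤n squarefree = begin
  prodP (map Φ (filterᵇ unitaryCofactor (filterᵇ (_∣ᵇ n) (range n))))
    ≡⟨ cong (prodP ∘ map Φ) (filterᵇ-filterᵇ (_∣ᵇ n) unitaryCofactor (range n)) ⟩
  prodP (map Φ (filterᵇ selected (range n)))
    ≈⟨ prodP-filter-range Φ n selected ⟩
  ∏≤ Φ m selected ⊗ factorIf Φ selected n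
    ≈⟨ ⊗-cong (∏≤-none Φ m selected only-n) (≡⇒≋ (factorIf-true Φ selected {n} n-selected)) ⟩
  one ⊗ Φ n
    ≈⟨ ⊗-identityˡ (Φ n) ⟩
  Φ n ∎
  where
  open ≋-Reasoning
  n = suc m
  unitaryCofactor : ℕ → Bool
  unitaryCofactor d = ustar (n / suc (d ∸ 1)) n ≡ᵇ 1
  selected : ℕ → Bool
  selected d = d ∣ᵇ n ∧ unitaryCofactor d
  n-selected : selected n ≡ true
  n-selected =
    cong₂ _∧_ (∣ᵇ-true {n} ∣-refl) (cong (_≡ᵇ 1) (trans (cong (λ x → ustar x n) (n/n≡1 n)) (ustar-1 1≤n)))
  only-n : ∀ d → 1 ≤ d → d ≤ m → selected d ≡ false
  only-n (suc d′) 1≤d d≤m with suc d′ ∣? n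
  ... | no  _              = refl
  ... | yes (divides j n≡jd) = ≥2⇒≢ᵇ1 (subst (λ x → 2 ≤ ustar x n) (sym n/d≡j) (ℕ.≤-trans 2≤j j≤ustar))
    where
    n/d≡j : n / suc d′ ≡ j
    n/d≡j = trans (cong (_/ suc d′) n≡jd) (m*n/n≡m j (suc d′))
    2≤j : 2 ≤ j
    2≤j = cofactor-≥2 n≡jd (s≤s d≤m)
    j≤ustar : j ≤ ustar j n
    j≤ustar = ustar-squarefree squarefree n≡jd (ℕ.≤-trans (s≤s z≤n) 2≤j) 1≤d

proposition1 : (∀ (m : ℕ) → 1 ≤ m → ∃[ n ] (1 ≤ n × height (Φ n) ≡ m))
    → ∀ (m : ℕ) → 1 ≤ m → ∃[ n ] (1 ≤ n × height (Φ* n) ≡ m)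
proposition1 realised m 1≤m with realised m 1≤m
... | n , 1≤n , height-Φn≡m with squarefree-reduction 1≤n
...   | n′ , 1≤n′ , squarefree , height-Φn′≡Φn =
  n′ , 1≤n′ , trans (height-cong (Φ*-squarefree 1≤n′ squarefree)) (trans height-Φn′≡Φn height-Φn≡m)
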